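{- Let $m,n$ be positive integers, $C=(c_1,\dots,c_n)\in\mathrm{Mat}_{m\times n}(\mathbb{Z})$ with every column $c_j=(c_{1j},\dots,c_{mj})^T\neq0$, and $b=(b_1,\dots,b_n)\in\mathbb{Z}^n$. For $q\in\mathbb{Z}_{>0}$ and $J\subseteq[n]$ let $H_{J,q}=\{z\in\mathbb{Z}_q^m: z[c_j]_q=[b_j]_q\ \text{for all } j\in J\}$ (so $H_{\emptyset,q}=\mathbb{Z}_q^m$) and $H_{j,q}=H_{\{j\},q}$. For nonempty $J=\{j_1<\cdots<j_k\}$ let $C_J=(c_{j_1},\dots,c_{j_k})$, $b_J=(b_{j_1},\dots,b_{j_k})$, $A_J=\binom{C_J}{b_J}$, let $e(J)$ and $e'(J)$ be the largest elementary divisors over $\mathbb{Z}$ of $C_J$ and $A_J$ respectively. Define $\rho_0=\mathrm{lcm}\{e(J):\emptyset\ne J\subseteq[n]\}$, $q_0=\max\{e'(J): J\neq\emptyset,\ \mathrm{rank}\,A_J=\mathrm{rank}\,C_J+1\}$, $q_1=\max\{e(J\cup\{j\}): j\in[n],\ J\neq\emptyset,\ \mathrm{rank}\,C_{J\cup\{j\}}=\mathrm{rank}\,C_J+1\}$ (each maximum being $0$ if taken over the empty set), and $q^*=\max\{q_0,q_1,\max_{1\le j\le n}\gcd\{c_{1j},\dots,c_{mj}\}\}$, with the gcds taken positive. Suppose $q,q'\in\mathbb{Z}_{>0}$ satisfy $q,q'>q^*$ and $\gcd\{\rho_0,q\}=\gcd\{\rho_0,q'\}$. Then: (i) for every $J\subseteq[n]$,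 $H_{J,q}=\emptyset$ if and only if $H_{J,q'}=\emptyset$; (ii) for every $j\in[n]$ and every $J\subseteq[n]$ with $H_{J,q}\neq\emptyset$ and $H_{J,q'}\neq\emptyset$, we have $H_{j,q}\supseteq H_{J,q}$ if and only if $H_{j,q'}\supseteq H_{J,q'}$.
   Context: $[n]=\{1,\dots,n\}$, $\mathbb{Z}_q=\mathbb{Z}/q\mathbb{Z}$, $[\cdot]_q$ is entrywise reduction modulo $q$. For a nonzero integer matrix of rank $\ell$, its elementary divisors over $\mathbb{Z}$ are the positive integers $e_1\mid\cdots\mid e_\ell$ on the diagonal of its Smith normal form; the largest one is $e_\ell$. -}

module Defs where

open import Data.Bool using (Bool; true; false; _∧_; _∨_; if_then_else_)
open import Data.Nat as ℕ using (ℕ; zero; suc; _∸_; _<ᵇ_; _≡ᵇ_)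
open import Data.Nat.GCD using (gcd)
open import Data.Nat.LCM using (lcm)
open import Data.Fin using (Fin; zero; suc; toℕ)
open import Data.Integer as ℤ using (ℤ; +_; ∣_∣; 0ℤ; 1ℤ)
open import Data.Integer.Divisibility using () renaming (_∣_ to _∣ℤ_)
open import Data.Vec using (Vec; []; _∷_; _[_]≔_)
open import Data.List using (List; []; _∷_; map; foldr; filter; concatMap; _++_)
open import Data.Product using (Σ; _×_; _,_; ∃)
open import Relation.Binary.PropositionalEquality using (_≡_)
open import Relation.Nullary using (¬_)
open import Relation.Nullary.Decidable using (T?)
open import Data.Bool using (T)

Mat : ℕ → ℕ → Set
Mat r c = Fin r → Fin c → ℤ

Σℤ : ∀ {k} → (Fin k → ℤ) → ℤ
Σℤ {zero}  f = 0ℤ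
Σℤ {suc k} f = f zero ℤ.+ Σℤ (λ i → f (suc i))

_·_ : ∀ {r s t} → Mat r s → Mat s t → Mat r t
(A · B) i k = Σℤ (λ j → A i j ℤ.* B j k)

idM : ∀ {r} → Mat r r
idM i j = if toℕ i ≡ᵇ toℕ j then 1ℤ else 0ℤ

_≐_ : ∀ {r c} → Mat r c → Mat r c → Set
A ≐ B = ∀ i j → A i j ≡ B i j

Unimodular : ∀ {r} → Mat r r → Set
Unimodular {r} U = Σ (Mat r r) λ U' → ((U · U') ≐ idM) × ((U' · U) ≐ idM)

diagM : ∀ {r c} → ℕ → (ℕ → ℕ) → Mat r c
diagM ℓ d i j =
  if (toℕ i ≡ᵇ toℕ j) ∧ (toℕ i <ᵇ ℓ) then + (d (toℕ i)) else 0ℤ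

-- SNF A ℓ e : A has Smith normal form diag(e₁,…,e_ℓ,0,…) with positive
-- e₁ ∣ e₂ ∣ … ∣ e_ℓ, ℓ ≥ 1 (so A ≠ 0), ℓ = rank A, and e = e_ℓ is the
-- largest elementary divisor.  (d k stands for e_{k+1}.)
SNF : ∀ {r c} → Mat r c → ℕ → ℕ → Set
SNF {r} {c} A ℓ e =
  Σ (Mat r r) λ U → Σ (Mat c c) λ V → Σ (ℕ → ℕ) λ d →
    Unimodular U × Unimodular V ×
    ((U · A) · V) ≐ diagM ℓ d ×
    1 ℕ.≤ ℓ × ℓ ℕ.≤ r × ℓ ℕ.≤ c ×
    (∀ k → k ℕ.< ℓ → 0 ℕ.< d k) ×
    (∀ k → suc k ℕ.< ℓ → d k Data.Nat.Divisibility.∣ d (suc k)) ×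
    e ≡ d (ℓ ∸ 1)
  where import Data.Nat.Divisibility

-- Subsets of [n] as characteristic vectors (true = member)

Subset : ℕ → Set
Subset n = Vec Bool n

card : ∀ {n} → Subset n → ℕ
card []          = zero
card (true  ∷ J) = suc (card J)
card (false ∷ J) = card J

sel : ∀ {n} (J : Subset n) → Fin (card J) → Fin n
sel (true  ∷ J) zero    = zero
sel (true  ∷ J) (suc i) = suc (sel J i)
sel (false ∷ J) i       = suc (sel J i)

nonemptyᵇ : ∀ {n} → Subset n → Bool
nonemptyᵇ []      = false
nonemptyᵇ (x ∷ J) = x ∨ nonemptyᵇ J

_∈_ : ∀ {n} → Fin n → Subset n → Set
j ∈ J = T (Data.Vec.lookup J j)
  where import Data.Vec

allSubsets : ∀ n → List (Subset n)
allSubsets zero    = [] ∷ []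
allSubsets (suc n) = map (true ∷_) (allSubsets n) ++ map (false ∷_) (allSubsets n)

allFin : ∀ n → List (Fin n)
allFin zero    = []
allFin (suc n) = zero ∷ map suc (allFin n)

insert : ∀ {n} → Fin n → Subset n → Subset n
insert j J = J [ j ]≔ true

subC : ∀ {m n} → Mat m n → (J : Subset n) → Mat m (card J)
subC C J i k = C i (sel J k)

snocF : ∀ {m} {X : Set} → (Fin m → X) → X → Fin (suc m) → X
snocF {zero}  f x zero    = x
snocF {suc m} f x zero    = f zero
snocF {suc m} f x (suc i) = snocF (λ i → f (suc i)) x i

subA : ∀ {m n} → Mat m n → (Fin n → ℤ) → (J : Subset n) → Mat (suc m) (card J)
subA C b J i k = snocF (λ i' → C i' (sel J k)) (b (sel J k)) i

-- The constants (given e, e', rank C_J, rank A_J as functions of J)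

maxL : List ℕ → ℕ
maxL = foldr ℕ._⊔_ 0

lcmL : List ℕ → ℕ
lcmL = foldr lcm 1

ρ₀ : ∀ {n} → (e : Subset n → ℕ) → ℕ
ρ₀ {n} e = lcmL (map e (filter (λ J → T? (nonemptyᵇ J)) (allSubsets n)))

q₀ : ∀ {n} → (e' rC rA : Subset n → ℕ) → ℕ
q₀ {n} e' rC rA =
  maxL (map e' (filter (λ J → T? (nonemptyᵇ J ∧ (rA J ≡ᵇ suc (rC J)))) (allSubsets n)))

q₁ : ∀ {n} → (e rC : Subset n → ℕ) → ℕ
q₁ {n} e rC =
  maxL (concatMap
          (λ J → concatMap
             (λ j → if nonemptyᵇ J ∧ (rC (insert j J) ≡ᵇ suc (rC J))
                      then e (insert j J) ∷ [] else [])
             (allFin n))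
          (allSubsets n))

colGcd : ∀ {m n} → Mat m n → Fin n → ℕ
colGcd {m} C j = foldr gcd 0 (map (λ i → ∣ C i j ∣) (allFin m))

qStar : ∀ {m n} → Mat m n → (e e' rC rA : Subset n → ℕ) → ℕ
qStar {m} {n} C e e' rC rA =
  q₀ e' rC rA ℕ.⊔ q₁ e rC ℕ.⊔ maxL (map (colGcd C) (allFin n))

-- H_{J,q}, with elements of ℤ_q^m represented by integer vectors z

solves : ∀ {m n} → Mat m n → (Fin n → ℤ) → ℕ → (Fin m → ℤ) → Fin n → Set
solves C b q z j = (+ q) ∣ℤ (Σℤ (λ i → z i ℤ.* C i j) ℤ.- b j)

InH : ∀ {m n} → Mat m n → (Fin n → ℤ) → Subset n → ℕ → (Fin m → ℤ) → Set
InH C b J q z = ∀ j → j ∈ J → solves C b q z j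

HEmpty : ∀ {m n} → Mat m n → (Fin n → ℤ) → Subset n → ℕ → Set
HEmpty {m} C b J q = ¬ (∃ λ (z : Fin m → ℤ) → InH C b J q z)

HNonempty : ∀ {m n} → Mat m n → (Fin n → ℤ) → Subset n → ℕ → Set
HNonempty {m} C b J q = ∃ λ (z : Fin m → ℤ) → InH C b J q z

HSup : ∀ {m n} → Mat m n → (Fin n → ℤ) → Fin n → Subset n → ℕ → Set
HSup {m} C b j J q = ∀ (z : Fin m → ℤ) → InH C b J q z → solves C b q z j

module Submission where

-- Let U C_J V = diag(d₀, …, d_{ℓ-1}, 0, …) be a Smith normal form. Writing w = z U⁻¹
-- and β = b_J V, the system z C_J ≡ b_J (mod q) becomes w_t d_t ≡ β_t for t < ℓ and
-- 0 ≡ β_t for t ≥ ℓ. If some β_t with t ≥ ℓ is nonzero, then rank A_J = ℓ + 1 and every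
-- common divisor of the β_t (t ≥ ℓ) divides e'(J) ≤ q*; so for q > q* the tail of β
-- vanishes and solvability only depends on whether gcd(d_t, q) ∣ β_t. As d_t ∣ e(J) ∣ ρ₀,
-- gcd(d_t, q) = gcd(d_t, gcd(ρ₀, q)) is the same for q and q'.
-- When H_{J,q} ≠ ∅, the containment H_{J,q} ⊆ H_{j,q} says that z C_J ≡ 0 forces
-- z c_j ≡ 0 (mod q). The same analysis, run on the transpose of C_{J∪{j}} with
-- e(J ∪ {j}) ≤ q₁ in place of e'(J), transfers this from q to q'. For J = ∅ the
-- containment would make q divide every entry of c_j, which q > q* excludes.

open import Defs
open import Data.Nat as ℕ using (ℕ; zero; suc; z≤n; s≤s; _≡ᵇ_; _<ᵇ_; _∸_; _<_; _≤_)
import Data.Nat.Properties as ℕP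
import Data.Nat.Divisibility as ℕD
open import Data.Nat.GCD as G using (gcd)
open import Data.Nat.LCM using (m∣lcm[m,n]; n∣lcm[m,n])
open import Data.Integer as ℤ using (ℤ; 0ℤ; 1ℤ; _+_; _*_; -_; _-_)
import Data.Integer.Properties as ℤP
open import Data.Integer.Divisibility.Signed using (_∣_; divides; quotient; ∣ᵤ⇒∣; ∣⇒∣ᵤ; ∣-trans; ∣m∣n⇒∣m+n; ∣m⇒∣-m; ∣m∣n⇒∣m-n; ∣n⇒∣m*n; ∣m⇒∣m*n) renaming (*-cancelˡ-∣ to ∣*-cancelˡ)
open import Data.Integer.Tactic.RingSolver
open import Data.Fin as F using (Fin; zero; suc; toℕ; fromℕ<)
import Data.Fin.Properties as FP
open import Data.Vec using ([]; _∷_; lookup)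
import Data.Vec.Properties as VP
open import Data.List using (List; []; _∷_; map; foldr; concatMap)
open import Data.List.Membership.Propositional renaming (_∈_ to _∈L_)
open import Data.List.Membership.Propositional.Properties
open import Data.List.Relation.Unary.Any using (here; there)
open import Data.Bool using (Bool; true; false; if_then_else_; _∧_; T)
open import Data.Unit using (tt)
open import Data.Product using (Σ; _×_; _,_; proj₁; proj₂)
open import Data.Sum using (_⊎_; inj₁; inj₂)
open import Data.Empty using (⊥; ⊥-elim)
open import Function.Bundles using (_⇔_; mk⇔)
open import Relation.Binary.PropositionalEquality
open import Relation.Nullary using (¬_; Dec; yes; no)
open import Relation.Nullary.Decidable using (T?)

-- Vectors and matrices are indexed by ℕ; only the entries below the dimensions in
-- play matter, and equalities (VecEq, MatEq) are only asserted there.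
Vector : Set
Vector = ℕ → ℤ

Matrix : Set
Matrix = ℕ → ℕ → ℤ

∑ : ℕ → Vector → ℤ
∑ zero f = 0ℤ
∑ (suc n) f = f 0 + ∑ n (λ i → f (suc i))

∑-cong : ∀ n {f g : Vector} → (∀ i → i ℕ.< n → f i ≡ g i) → ∑ n f ≡ ∑ n g
∑-cong zero h = refl
∑-cong (suc n) h = cong₂ _+_ (h 0 (s≤s z≤n)) (∑-cong n (λ i i<n → h (suc i) (s≤s i<n)))

∑-zero : ∀ n {f : Vector} → (∀ i → i ℕ.< n → f i ≡ 0ℤ) → ∑ n f ≡ 0ℤ
∑-zero zero h = refl
∑-zero (suc n) h rewrite h 0 (s≤s z≤n) | ∑-zero n (λ i i<n → h (suc i) (s≤s i<n)) = refl

∑-distrib-+ : ∀ n (f g : Vector) → ∑ n (λ i → f i + g i) ≡ ∑ n f + ∑ n g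
∑-distrib-+ zero f g = refl
∑-distrib-+ (suc n) f g rewrite ∑-distrib-+ n (λ i → f (suc i)) (λ i → g (suc i)) =
  lem (f 0) (g 0) (∑ n (λ i → f (suc i))) (∑ n (λ i → g (suc i)))
  where
  lem : ∀ a b c d → (a + b) + (c + d) ≡ (a + c) + (b + d)
  lem = solve-∀

∑-*ˡ : ∀ n (c : ℤ) (f : Vector) → ∑ n (λ i → c * f i) ≡ c * ∑ n f
∑-*ˡ zero c f = sym (ℤP.*-zeroʳ c)
∑-*ˡ (suc n) c f rewrite ∑-*ˡ n c (λ i → f (suc i)) = sym (ℤP.*-distribˡ-+ c (f 0) _)

∑-*ʳ : ∀ n (c : ℤ) (f : Vector) → ∑ n (λ i → f i * c) ≡ ∑ n f * c
∑-*ʳ n c f = trans (∑-cong n (λ i _ → ℤP.*-comm (f i) c)) (trans (∑-*ˡ n c f) (ℤP.*-comm c _))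

∑-neg : ∀ n (f : Vector) → ∑ n (λ i → - f i) ≡ - ∑ n f
∑-neg n f = trans (∑-cong n (λ i _ → sym (ℤP.-1*i≡-i (f i)))) (trans (∑-*ˡ n (ℤ.-[1+ 0 ]) f) (ℤP.-1*i≡-i _))

∑-distrib-- : ∀ n (f g : Vector) → ∑ n (λ i → f i - g i) ≡ ∑ n f - ∑ n g
∑-distrib-- n f g = trans (∑-distrib-+ n f (λ i → - g i)) (cong (∑ n f +_) (∑-neg n g))

∑-swap : ∀ n m (f : ℕ → ℕ → ℤ) → ∑ n (λ i → ∑ m (λ j → f i j)) ≡ ∑ m (λ j → ∑ n (λ i → f i j))
∑-swap zero m f = sym (∑-zero m (λ _ _ → refl))
∑-swap (suc n) m f =
  trans (cong (∑ m (λ j → f 0 j) +_) (∑-swap n m (λ i j → f (suc i) j)))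
        (sym (∑-distrib-+ m (λ j → f 0 j) (λ j → ∑ n (λ i → f (suc i) j))))

∑-suc : ∀ n (f : Vector) → ∑ (suc n) f ≡ ∑ n f + f n
∑-suc zero f = ℤP.+-comm (f 0) 0ℤ
∑-suc (suc n) f rewrite ∑-suc n (λ i → f (suc i)) = sym (ℤP.+-assoc (f 0) _ _)

∑-truncate : ∀ l n (f : Vector) → l ℕ.≤ n → (∀ i → l ℕ.≤ i → i ℕ.< n → f i ≡ 0ℤ) → ∑ n f ≡ ∑ l f
∑-truncate zero n f _ h = ∑-zero n (λ i i<n → h i z≤n i<n)
∑-truncate (suc l) (suc n) f (s≤s l≤n) h =
  cong (f 0 +_) (∑-truncate l n (λ i → f (suc i)) l≤n (λ i l≤i i<n → h (suc i) (s≤s l≤i) (s≤s i<n)))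

δ : ℕ → ℕ → ℤ
δ i j = if i ≡ᵇ j then 1ℤ else 0ℤ

δ-sym : ∀ i j → δ i j ≡ δ j i
δ-sym zero zero = refl
δ-sym zero (suc j) = refl
δ-sym (suc i) zero = refl
δ-sym (suc i) (suc j) = δ-sym i j

δ-diag : ∀ i → δ i i ≡ 1ℤ
δ-diag zero = refl
δ-diag (suc i) = δ-diag i

δ-off : ∀ i j → ¬ i ≡ j → δ i j ≡ 0ℤ
δ-off zero zero h = ⊥-elim (h refl)
δ-off zero (suc j) h = refl
δ-off (suc i) zero h = refl
δ-off (suc i) (suc j) h = δ-off i j (λ e → h (cong suc e))

∑-δˡ : ∀ n k (f : Vector) → k ℕ.< n → ∑ n (λ i → δ i k * f i) ≡ f k
∑-δˡ (suc n) zero f _ =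
  trans (cong₂ _+_ (ℤP.*-identityˡ (f 0)) (∑-zero n (λ i _ → ℤP.*-zeroˡ (f (suc i))))) (ℤP.+-identityʳ _)
∑-δˡ (suc n) (suc k) f (s≤s k<n) =
  trans (cong₂ _+_ (ℤP.*-zeroˡ (f 0)) (∑-δˡ n k (λ i → f (suc i)) k<n)) (ℤP.+-identityˡ _)

∑-δˡ-outside : ∀ n k (f : Vector) → n ℕ.≤ k → ∑ n (λ i → δ i k * f i) ≡ 0ℤ
∑-δˡ-outside n k f n≤k = ∑-zero n (λ i i<n → trans (cong (_* f i) (δ-off i k (λ e → ℕP.<-irrefl e (ℕP.<-≤-trans i<n n≤k)))) (ℤP.*-zeroˡ (f i)))

∑-δʳ : ∀ n k (f : Vector) → k ℕ.< n → ∑ n (λ i → f i * δ i k) ≡ f k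
∑-δʳ n k f k<n = trans (∑-cong n (λ i _ → ℤP.*-comm (f i) (δ i k))) (∑-δˡ n k f k<n)

infixl 7 _⋆⟨_⟩_ _⊙⟨_⟩_

_⋆⟨_⟩_ : Vector → ℕ → Matrix → Vector
(v ⋆⟨ n ⟩ M) j = ∑ n (λ i → v i * M i j)

_⊙⟨_⟩_ : Matrix → ℕ → Matrix → Matrix
(A ⊙⟨ n ⟩ B) i k = ∑ n (λ j → A i j * B j k)

Id : Matrix
Id = δ

VecEq : ℕ → Vector → Vector → Set
VecEq n u v = ∀ i → i ℕ.< n → u i ≡ v i

MatEq : ℕ → ℕ → Matrix → Matrix → Set
MatEq r c A B = ∀ i j → i ℕ.< r → j ℕ.< c → A i j ≡ B i j

⋆-assoc : ∀ n p (v : Vector) (A B : Matrix) j → ((v ⋆⟨ n ⟩ A) ⋆⟨ p ⟩ B) j ≡ (v ⋆⟨ n ⟩ (A ⊙⟨ p ⟩ B)) j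
⋆-assoc n p v A B j =
  begin
    ∑ p (λ k → ∑ n (λ i → v i * A i k) * B k j)
  ≡⟨ ∑-cong p (λ k _ → sym (∑-*ʳ n (B k j) (λ i → v i * A i k))) ⟩
    ∑ p (λ k → ∑ n (λ i → v i * A i k * B k j))
  ≡⟨ ∑-swap p n (λ k i → v i * A i k * B k j) ⟩
    ∑ n (λ i → ∑ p (λ k → v i * A i k * B k j))
  ≡⟨ ∑-cong n (λ i _ → trans (∑-cong p (λ k _ → ℤP.*-assoc (v i) (A i k) (B k j))) (∑-*ˡ p (v i) (λ k → A i k * B k j))) ⟩
    ∑ n (λ i → v i * ∑ p (λ k → A i k * B k j))
  ∎
  where open ≡-Reasoning

⊙-assoc : ∀ n p (A B C : Matrix) i j → ((A ⊙⟨ n ⟩ B) ⊙⟨ p ⟩ C) i j ≡ (A ⊙⟨ n ⟩ (B ⊙⟨ p ⟩ C)) i j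
⊙-assoc n p A B C i j = ⋆-assoc n p (A i) B C j

⋆-congˡ : ∀ n {u v : Vector} (M : Matrix) → VecEq n u v → ∀ j → (u ⋆⟨ n ⟩ M) j ≡ (v ⋆⟨ n ⟩ M) j
⋆-congˡ n M h j = ∑-cong n (λ i i<n → cong (_* M i j) (h i i<n))

⋆-congʳ : ∀ n c (v : Vector) {A B : Matrix} → MatEq n c A B → VecEq c (v ⋆⟨ n ⟩ A) (v ⋆⟨ n ⟩ B)
⋆-congʳ n c v h j j<c = ∑-cong n (λ i i<n → cong (v i *_) (h i j i<n j<c))

⋆-identityʳ : ∀ n (v : Vector) → VecEq n (v ⋆⟨ n ⟩ Id) v
⋆-identityʳ n v j j<n = ∑-δʳ n j v j<n

⋆-identityʳ-≈ : ∀ n (v : Vector) {A : Matrix} → MatEq n n A Id → VecEq n (v ⋆⟨ n ⟩ A) v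
⋆-identityʳ-≈ n v h j j<n = trans (⋆-congʳ n n v h j j<n) (⋆-identityʳ n v j j<n)

⋆-inverseʳ : ∀ n (v : Vector) (A B : Matrix) → MatEq n n (A ⊙⟨ n ⟩ B) Id → VecEq n ((v ⋆⟨ n ⟩ A) ⋆⟨ n ⟩ B) v
⋆-inverseʳ n v A B h j j<n = trans (⋆-assoc n n v A B j) (⋆-identityʳ-≈ n v h j j<n)

⋆-distribʳ-+ : ∀ n (u v : Vector) (M : Matrix) j → ((λ i → u i + v i) ⋆⟨ n ⟩ M) j ≡ (u ⋆⟨ n ⟩ M) j + (v ⋆⟨ n ⟩ M) j
⋆-distribʳ-+ n u v M j = trans (∑-cong n (λ i _ → ℤP.*-distribʳ-+ (M i j) (u i) (v i))) (∑-distrib-+ n _ _)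

⋆-*ˡ : ∀ n (c : ℤ) (u : Vector) (M : Matrix) j → ((λ i → c * u i) ⋆⟨ n ⟩ M) j ≡ c * (u ⋆⟨ n ⟩ M) j
⋆-*ˡ n c u M j = trans (∑-cong n (λ i _ → ℤP.*-assoc c (u i) (M i j))) (∑-*ˡ n c _)

_ᵀ : Matrix → Matrix
(A ᵀ) i j = A j i

⊙-ᵀ : ∀ n (A B : Matrix) i j → ((A ⊙⟨ n ⟩ B) ᵀ) i j ≡ ((B ᵀ) ⊙⟨ n ⟩ (A ᵀ)) i j
⊙-ᵀ n A B i j = ∑-cong n (λ k _ → ℤP.*-comm (A j k) (B k i))

⊙-conjugate-inverse : ∀ n (A B C D : Matrix) → MatEq n n (A ⊙⟨ n ⟩ B) Id → MatEq n n (C ⊙⟨ n ⟩ D) Id →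
           MatEq n n ((A ⊙⟨ n ⟩ C) ⊙⟨ n ⟩ (D ⊙⟨ n ⟩ B)) Id
⊙-conjugate-inverse n A B C D hAB hCD i j i<n j<n =
  begin
    ((A ⊙⟨ n ⟩ C) ⊙⟨ n ⟩ (D ⊙⟨ n ⟩ B)) i j
  ≡⟨ sym (⋆-assoc n n (A i ⋆⟨ n ⟩ C) D B j) ⟩
    (((A i ⋆⟨ n ⟩ C) ⋆⟨ n ⟩ D) ⋆⟨ n ⟩ B) j
  ≡⟨ ⋆-congˡ n B (⋆-inverseʳ n (A i) C D hCD) j ⟩
    (A ⊙⟨ n ⟩ B) i j
  ≡⟨ hAB i j i<n j<n ⟩
    Id i j
  ∎
  where open ≡-Reasoning

∑-const : ∀ n (c : ℤ) → ∑ n (λ _ → c) ≡ ℤ.+ n * c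
∑-const zero c = sym (ℤP.*-zeroˡ c)
∑-const (suc n) c = trans (cong (c +_) (∑-const n c)) (sym (ℤP.suc-* (ℤ.+ n) c))

*-cancelˡ-≢0 : ∀ (c a b : ℤ) → ¬ c ≡ 0ℤ → c * a ≡ c * b → a ≡ b
*-cancelˡ-≢0 c a b c≢0 eq = ℤP.*-cancelˡ-≡ c a b {{ℤ.≢-nonZero c≢0}} eq

*-cancelˡ-≡0 : ∀ (c a : ℤ) → ¬ c ≡ 0ℤ → c * a ≡ 0ℤ → a ≡ 0ℤ
*-cancelˡ-≡0 c a c≢0 eq = *-cancelˡ-≢0 c a 0ℤ c≢0 (trans eq (sym (ℤP.*-zeroʳ c)))

<⇒<ᵇ≡true : ∀ {t l} → t ℕ.< l → (t <ᵇ l) ≡ true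
<⇒<ᵇ≡true {zero} {suc l} _ = refl
<⇒<ᵇ≡true {suc t} {suc l} (s≤s p) = <⇒<ᵇ≡true {t} {l} p

≤⇒<ᵇ≡false : ∀ {t l} → l ℕ.≤ t → (t <ᵇ l) ≡ false
≤⇒<ᵇ≡false {t} {zero} _ = refl
≤⇒<ᵇ≡false {suc t} {suc l} (s≤s p) = ≤⇒<ᵇ≡false {t} {l} p

≡ᵇ-refl : ∀ n → (n ≡ᵇ n) ≡ true
≡ᵇ-refl zero = refl
≡ᵇ-refl (suc n) = ≡ᵇ-refl n

≡ᵇ-≢ : ∀ i n → ¬ i ≡ n → (i ≡ᵇ n) ≡ false
≡ᵇ-≢ zero zero h = ⊥-elim (h refl)
≡ᵇ-≢ zero (suc n) h = refl
≡ᵇ-≢ (suc i) zero h = refl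
≡ᵇ-≢ (suc i) (suc n) h = ≡ᵇ-≢ i n (λ e → h (cong suc e))

finite-choice : ∀ {A : Set} {P : ℕ → A → Set} (l : ℕ) → A → (∀ t → t ℕ.< l → Σ A (P t)) →
         Σ (ℕ → A) λ c → ∀ t → t ℕ.< l → P t (c t)
finite-choice {A} {P} l a h = c , spec
  where
  c : ℕ → A
  c t with t ℕ.<? l
  ... | yes p = proj₁ (h t p)
  ... | no _ = a
  spec : ∀ t → t ℕ.< l → P t (c t)
  spec t t<l with t ℕ.<? l
  ... | yes p = proj₂ (h t p)
  ... | no np = ⊥-elim (np t<l)

diag : ℕ → (ℕ → ℕ) → Matrix
diag l d i j = if (i ≡ᵇ j) ∧ (i <ᵇ l) then ℤ.+ d i else 0ℤ

diagVec : ℕ → (ℕ → ℕ) → Vector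
diagVec l d t = if t <ᵇ l then ℤ.+ d t else 0ℤ

scaleDiag : ℕ → (ℕ → ℕ) → Vector → Vector
scaleDiag l d x t = x t * diagVec l d t

diagVec-< : ∀ l d t → t ℕ.< l → diagVec l d t ≡ ℤ.+ d t
diagVec-< l d t p rewrite <⇒<ᵇ≡true p = refl

diagVec-≥ : ∀ l d t → l ℕ.≤ t → diagVec l d t ≡ 0ℤ
diagVec-≥ l d t p rewrite ≤⇒<ᵇ≡false {t} {l} p = refl

scaleDiag-≥ : ∀ l d x t → l ℕ.≤ t → scaleDiag l d x t ≡ 0ℤ
scaleDiag-≥ l d x t p = trans (cong (x t *_) (diagVec-≥ l d t p)) (ℤP.*-zeroʳ (x t))

scaleDiag-< : ∀ l d x t → t ℕ.< l → scaleDiag l d x t ≡ x t * ℤ.+ d t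
scaleDiag-< l d x t p = cong (x t *_) (diagVec-< l d t p)

diag-δ : ∀ l d i j → diag l d i j ≡ δ i j * diagVec l d j
diag-δ l d i j with i ≡ᵇ j in eq
... | true with ℕP.≡ᵇ⇒≡ i j (subst T (sym eq) tt)
...   | refl = sym (ℤP.*-identityˡ _)
diag-δ l d i j | false = sym (ℤP.*-zeroˡ (diagVec l d j))

⋆-diag : ∀ R l d x t → l ℕ.≤ R → (x ⋆⟨ R ⟩ diag l d) t ≡ scaleDiag l d x t
⋆-diag R l d x t l≤R =
  trans (∑-cong R (λ i _ → trans (cong (x i *_) (diag-δ l d i t)) (lem (x i) (δ i t) (diagVec l d t))))
        (cases (t ℕ.<? R))
  where
  lem : ∀ a b c → a * (b * c) ≡ b * (a * c)
  lem = solve-∀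
  cases : Dec (t ℕ.< R) → ∑ R (λ i → δ i t * (x i * diagVec l d t)) ≡ scaleDiag l d x t
  cases (yes p) = ∑-δˡ R t (λ i → x i * diagVec l d t) p
  cases (no np) = trans (∑-δˡ-outside R t _ (ℕP.≮⇒≥ np)) (sym (scaleDiag-≥ l d x t (ℕP.≤-trans l≤R (ℕP.≮⇒≥ np))))

∸1< : ∀ {l} → 1 ℕ.≤ l → l ∸ 1 ℕ.< l
∸1< {suc l} _ = ℕP.n<1+n l

1+[∸1]≤ : ∀ {l} → 1 ℕ.≤ l → suc (l ∸ 1) ℕ.≤ l
1+[∸1]≤ {suc l} _ = ℕP.≤-refl

<⇒≤∸1 : ∀ {l k} → 1 ℕ.≤ l → k ℕ.< l → k ℕ.≤ l ∸ 1
<⇒≤∸1 {suc l} _ (s≤s p) = p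

record SmithForm (r c : ℕ) (A : Matrix) (l e : ℕ) : Set where
  field
    U U' V V' : Matrix
    d : ℕ → ℕ
    UU' : MatEq r r (U ⊙⟨ r ⟩ U') Id
    U'U : MatEq r r (U' ⊙⟨ r ⟩ U) Id
    VV' : MatEq c c (V ⊙⟨ c ⟩ V') Id
    V'V : MatEq c c (V' ⊙⟨ c ⟩ V) Id
    dia : MatEq r c ((U ⊙⟨ r ⟩ A) ⊙⟨ c ⟩ V) (diag l d)
    1≤l : 1 ℕ.≤ l
    l≤r : l ℕ.≤ r
    l≤c : l ℕ.≤ c
    pos : ∀ k → k ℕ.< l → 0 ℕ.< d k
    chain : ∀ k → suc k ℕ.< l → d k ℕD.∣ d (suc k)
    e≡ : e ≡ d (l ∸ 1)

module SmithFormProperties {r c : ℕ} {A : Matrix} {l e : ℕ} (H : SmithForm r c A l e) where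
  open SmithForm H

  ⋆A⋆V≡scale⋆U′ : ∀ u → VecEq c ((u ⋆⟨ r ⟩ A) ⋆⟨ c ⟩ V) (scaleDiag l d (u ⋆⟨ r ⟩ U'))
  ⋆A⋆V≡scale⋆U′ u j j<c =
    begin
      ((u ⋆⟨ r ⟩ A) ⋆⟨ c ⟩ V) j
    ≡⟨ ⋆-congˡ c V (λ i i<c → ⋆-congˡ r A (λ k k<r → sym (⋆-inverseʳ r u U' U U'U k k<r)) i) j ⟩
      ((((u ⋆⟨ r ⟩ U') ⋆⟨ r ⟩ U) ⋆⟨ r ⟩ A) ⋆⟨ c ⟩ V) j
    ≡⟨ ⋆-congˡ c V (λ i _ → ⋆-assoc r r (u ⋆⟨ r ⟩ U') U A i) j ⟩
      (((u ⋆⟨ r ⟩ U') ⋆⟨ r ⟩ (U ⊙⟨ r ⟩ A)) ⋆⟨ c ⟩ V) j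
    ≡⟨ ⋆-assoc r c (u ⋆⟨ r ⟩ U') (U ⊙⟨ r ⟩ A) V j ⟩
      ((u ⋆⟨ r ⟩ U') ⋆⟨ r ⟩ ((U ⊙⟨ r ⟩ A) ⊙⟨ c ⟩ V)) j
    ≡⟨ ⋆-congʳ r c (u ⋆⟨ r ⟩ U') dia j j<c ⟩
      ((u ⋆⟨ r ⟩ U') ⋆⟨ r ⟩ diag l d) j
    ≡⟨ ⋆-diag r l d (u ⋆⟨ r ⟩ U') j l≤r ⟩
      scaleDiag l d (u ⋆⟨ r ⟩ U') j
    ∎
    where open ≡-Reasoning

  ⋆U⋆A⋆V≡scale : ∀ x → VecEq c (((x ⋆⟨ r ⟩ U) ⋆⟨ r ⟩ A) ⋆⟨ c ⟩ V) (scaleDiag l d x)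
  ⋆U⋆A⋆V≡scale x j j<c =
    begin
      (((x ⋆⟨ r ⟩ U) ⋆⟨ r ⟩ A) ⋆⟨ c ⟩ V) j
    ≡⟨ ⋆-congˡ c V (λ i _ → ⋆-assoc r r x U A i) j ⟩
      ((x ⋆⟨ r ⟩ (U ⊙⟨ r ⟩ A)) ⋆⟨ c ⟩ V) j
    ≡⟨ ⋆-assoc r c x (U ⊙⟨ r ⟩ A) V j ⟩
      (x ⋆⟨ r ⟩ ((U ⊙⟨ r ⟩ A) ⊙⟨ c ⟩ V)) j
    ≡⟨ ⋆-congʳ r c x dia j j<c ⟩
      (x ⋆⟨ r ⟩ diag l d) j
    ≡⟨ ⋆-diag r l d x j l≤r ⟩
      scaleDiag l d x j
    ∎
    where open ≡-Reasoning

  private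
    d∣d-last : ∀ n k → k ℕ.+ n ≡ l ∸ 1 → d k ℕD.∣ d (l ∸ 1)
    d∣d-last zero k eq rewrite ℕP.+-identityʳ k | eq = ℕD.∣-refl
    d∣d-last (suc n) k eq = ℕD.∣-trans (chain k 1+k<l) (d∣d-last n (suc k) (trans (sym (ℕP.+-suc k n)) eq))
      where
      1+k<l : suc k ℕ.< l
      1+k<l = ℕP.<-≤-trans (s≤s (subst (suc k ℕ.≤_) eq (subst (suc k ℕ.≤_) (sym (ℕP.+-suc k n)) (s≤s (ℕP.m≤m+n k n))))) (1+[∸1]≤ 1≤l)

  d∣e : ∀ k → k ℕ.< l → d k ℕD.∣ e
  d∣e k k<l = subst (d k ℕD.∣_) (sym e≡) (d∣d-last (l ∸ 1 ∸ k) k (ℕP.m+[n∸m]≡n (<⇒≤∸1 1≤l k<l)))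

  e>0 : 0 ℕ.< e
  e>0 = subst (0 ℕ.<_) (sym e≡) (pos (l ∸ 1) (∸1< 1≤l))

  e-quotients : Σ (ℕ → ℤ) λ q → ∀ k → k ℕ.< l → ℤ.+ e ≡ q k * ℤ.+ d k
  e-quotients = finite-choice l 0ℤ (λ k k<l → f (d∣e k k<l))
    where
    f : ∀ {k} → d k ℕD.∣ e → Σ ℤ λ q → ℤ.+ e ≡ q * ℤ.+ d k
    f {k} (ℕD.divides q eq) = ℤ.+ q , trans (cong ℤ.+_ eq) (ℤP.pos-* q (d k))

Id-ᵀ : ∀ n {A : Matrix} → MatEq n n A Id → MatEq n n (A ᵀ) Id
Id-ᵀ n h i j a b = trans (h j i b a) (δ-sym j i)

diag-sym : ∀ l d i j → diag l d j i ≡ diag l d i j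
diag-sym l d i j = trans (diag-δ l d j i) (trans (lem (i ℕ.≟ j)) (sym (diag-δ l d i j)))
  where
  lem : Dec (i ≡ j) → δ j i * diagVec l d i ≡ δ i j * diagVec l d j
  lem (yes refl) = refl
  lem (no i≢j) = trans (cong (_* diagVec l d i) (δ-off j i (λ e → i≢j (sym e))))
                   (trans (ℤP.*-zeroˡ (diagVec l d i)) (sym (trans (cong (_* diagVec l d j) (δ-off i j i≢j)) (ℤP.*-zeroˡ (diagVec l d j)))))

SmithForm-ᵀ : ∀ {r c A l e} → SmithForm r c A l e → SmithForm c r (A ᵀ) l e
SmithForm-ᵀ {r} {c} {A} {l} {e} H = record
  { U = V ᵀ ; U' = V' ᵀ ; V = U ᵀ ; V' = U' ᵀ ; d = d
  ; UU' = λ i j a b → trans (sym (⊙-ᵀ c V' V i j)) (Id-ᵀ c V'V i j a b)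
  ; U'U = λ i j a b → trans (sym (⊙-ᵀ c V V' i j)) (Id-ᵀ c VV' i j a b)
  ; VV' = λ i j a b → trans (sym (⊙-ᵀ r U' U i j)) (Id-ᵀ r U'U i j a b)
  ; V'V = λ i j a b → trans (sym (⊙-ᵀ r U U' i j)) (Id-ᵀ r UU' i j a b)
  ; dia = transposed-diagonal
  ; 1≤l = 1≤l ; l≤r = l≤c ; l≤c = l≤r ; pos = pos ; chain = chain ; e≡ = e≡ }
  where
  open SmithForm H
  transposed-diagonal : ∀ i j → i ℕ.< c → j ℕ.< r → ((V ᵀ ⊙⟨ c ⟩ A ᵀ) ⊙⟨ r ⟩ U ᵀ) i j ≡ diag l d i j
  transposed-diagonal i j a b =
    begin
      ((V ᵀ ⊙⟨ c ⟩ A ᵀ) ⊙⟨ r ⟩ U ᵀ) i j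
    ≡⟨ ∑-cong r (λ k _ → cong (_* U j k) (sym (⊙-ᵀ c A V i k))) ⟩
      ((((A ⊙⟨ c ⟩ V) ᵀ) ⊙⟨ r ⟩ U ᵀ) i j)
    ≡⟨ sym (⊙-ᵀ r U (A ⊙⟨ c ⟩ V) i j) ⟩
      (U ⊙⟨ r ⟩ (A ⊙⟨ c ⟩ V)) j i
    ≡⟨ sym (⊙-assoc r c U A V j i) ⟩
      ((U ⊙⟨ r ⟩ A) ⊙⟨ c ⟩ V) j i
    ≡⟨ dia j i b a ⟩
      diag l d j i
    ≡⟨ diag-sym l d i j ⟩
      diag l d i j
    ∎
    where open ≡-Reasoning

extend : ∀ {n} → (Fin n → ℤ) → Vector
extend {zero} f i = 0ℤ
extend {suc n} f zero = f zero
extend {suc n} f (suc i) = extend (λ a → f (suc a)) i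

extend-toℕ : ∀ {n} (f : Fin n → ℤ) (a : Fin n) → extend f (toℕ a) ≡ f a
extend-toℕ {suc n} f zero = refl
extend-toℕ {suc n} f (suc a) = extend-toℕ (λ a → f (suc a)) a

extend-cong : ∀ {n} {f g : Fin n → ℤ} → (∀ a → f a ≡ g a) → ∀ i → extend f i ≡ extend g i
extend-cong {zero} h i = refl
extend-cong {suc n} h zero = h zero
extend-cong {suc n} h (suc i) = extend-cong (λ a → h (suc a)) i

extend-* : ∀ {n} (f g : Fin n → ℤ) i → extend (λ a → f a * g a) i ≡ extend f i * extend g i
extend-* {zero} f g i = refl
extend-* {suc n} f g zero = refl
extend-* {suc n} f g (suc i) = extend-* (λ a → f (suc a)) (λ a → g (suc a)) i

Σℤ≡∑ : ∀ {n} (f : Fin n → ℤ) → Σℤ f ≡ ∑ n (extend f)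
Σℤ≡∑ {zero} f = refl
Σℤ≡∑ {suc n} f = cong (f zero +_) (Σℤ≡∑ (λ a → f (suc a)))

below-by-Fin : ∀ {n} {P : ℕ → Set} → (∀ (a : Fin n) → P (toℕ a)) → ∀ i → i ℕ.< n → P i
below-by-Fin {P = P} h i i<n = subst P (FP.toℕ-fromℕ< i<n) (h (fromℕ< i<n))

extend₂ : ∀ {r c} → Mat r c → Matrix
extend₂ M i j = extend (λ b → extend (λ a → M a b) i) j

extend₂-toℕ : ∀ {r c} (M : Mat r c) a b → extend₂ M (toℕ a) (toℕ b) ≡ M a b
extend₂-toℕ M a b = trans (extend-toℕ (λ b → extend (λ a → M a b) (toℕ a)) b) (extend-toℕ (λ a → M a b) a)

extend₂-row : ∀ {r c} (M : Mat r c) a j → extend₂ M (toℕ a) j ≡ extend (M a) j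
extend₂-row M a j = extend-cong (λ b → extend-toℕ (λ a → M a b) a) j

extend₂-column : ∀ {r c} (M : Mat r c) i b → extend₂ M i (toℕ b) ≡ extend (λ a → M a b) i
extend₂-column M i b = extend-toℕ (λ b → extend (λ a → M a b) i) b

extend₂-· : ∀ {r s t} (A : Mat r s) (B : Mat s t) → MatEq r t (extend₂ (A · B)) (extend₂ A ⊙⟨ s ⟩ extend₂ B)
extend₂-· {r} {s} {t} A B i k i<r k<t =
  below-by-Fin {P = λ i → extend₂ (A · B) i k ≡ (extend₂ A ⊙⟨ s ⟩ extend₂ B) i k}
    (λ a → below-by-Fin {P = λ k → extend₂ (A · B) (toℕ a) k ≡ (extend₂ A ⊙⟨ s ⟩ extend₂ B) (toℕ a) k}
       (λ b → trans (extend₂-toℕ (A · B) a b)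
              (trans (Σℤ≡∑ (λ j → A a j * B j b))
              (∑-cong s (λ j _ → trans (extend-* (A a) (λ j → B j b) j)
                   (sym (cong₂ _*_ (extend₂-row A a j) (extend₂-column B j b)))))))
       k k<t) i i<r

MatEq-⊙ˡ : ∀ r s t {A A' : Matrix} (B : Matrix) → MatEq r s A A' → MatEq r t (A ⊙⟨ s ⟩ B) (A' ⊙⟨ s ⟩ B)
MatEq-⊙ˡ r s t B h i k i<r k<t = ⋆-congˡ s B (λ j j<s → h i j i<r j<s) k

MatEq-trans : ∀ {r c A B C} → MatEq r c A B → MatEq r c B C → MatEq r c A C
MatEq-trans h1 h2 i j a b = trans (h1 i j a b) (h2 i j a b)

MatEq-sym : ∀ {r c A B} → MatEq r c A B → MatEq r c B A
MatEq-sym h i j a b = sym (h i j a b)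

extend₂-≐ : ∀ {r c} {A B : Mat r c} {X : Matrix} → (A ≐ B) → MatEq r c (extend₂ B) X → MatEq r c (extend₂ A) X
extend₂-≐ {r} {c} {A} {B} {X} h hB i j i<r j<c =
  below-by-Fin {P = λ i → extend₂ A i j ≡ X i j}
    (λ a → below-by-Fin {P = λ j → extend₂ A (toℕ a) j ≡ X (toℕ a) j}
      (λ b → trans (extend₂-toℕ A a b) (trans (h a b) (trans (sym (extend₂-toℕ B a b)) (hB (toℕ a) (toℕ b) (FP.toℕ<n a) (FP.toℕ<n b)))))
      j j<c) i i<r

extend₂-idM : ∀ {r} → MatEq r r (extend₂ (idM {r})) Id
extend₂-idM {r} i j i<r j<r =
  below-by-Fin {P = λ i → extend₂ (idM {r}) i j ≡ Id i j}
    (λ a → below-by-Fin {P = λ j → extend₂ (idM {r}) (toℕ a) j ≡ Id (toℕ a) j}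
      (λ b → extend₂-toℕ (idM {r}) a b) j j<r) i i<r

extend₂-diagM : ∀ {r c} l d → MatEq r c (extend₂ (diagM {r} {c} l d)) (diag l d)
extend₂-diagM {r} {c} l d i j i<r j<c =
  below-by-Fin {P = λ i → extend₂ (diagM {r} {c} l d) i j ≡ diag l d i j}
    (λ a → below-by-Fin {P = λ j → extend₂ (diagM {r} {c} l d) (toℕ a) j ≡ diag l d (toℕ a) j}
      (λ b → extend₂-toℕ (diagM {r} {c} l d) a b) j j<c) i i<r

extend₂-inverse : ∀ {r} (U U' : Mat r r) → (U · U') ≐ idM → MatEq r r (extend₂ U ⊙⟨ r ⟩ extend₂ U') Id
extend₂-inverse {r} U U' h = MatEq-trans (MatEq-sym (extend₂-· U U')) (extend₂-≐ h extend₂-idM)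

SNF⇒SmithForm : ∀ {r c} {A : Mat r c} {l e} → SNF A l e → SmithForm r c (extend₂ A) l e
SNF⇒SmithForm {r} {c} {A} {l} {e} (U , V , d , (U' , UU' , U'U) , (V' , VV' , V'V) , dia , 1≤l , l≤r , l≤c , pos , chain , e≡) =
  record
    { U = extend₂ U ; U' = extend₂ U' ; V = extend₂ V ; V' = extend₂ V' ; d = d
    ; UU' = extend₂-inverse U U' UU' ; U'U = extend₂-inverse U' U U'U ; VV' = extend₂-inverse V V' VV' ; V'V = extend₂-inverse V' V V'V
    ; dia = MatEq-trans (MatEq-⊙ˡ r c c (extend₂ V) (MatEq-sym (extend₂-· U A)))
              (MatEq-trans (MatEq-sym (extend₂-· (U · A) V)) (extend₂-≐ dia (extend₂-diagM l d)))
    ; 1≤l = 1≤l ; l≤r = l≤r ; l≤c = l≤c ; pos = pos ; chain = chain ; e≡ = e≡ }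

∣0ℤ : ∀ k → k ∣ 0ℤ
∣0ℤ k = divides 0ℤ (sym (ℤP.*-zeroˡ k))

∣-respʳ : ∀ {k a b} → a ≡ b → k ∣ a → k ∣ b
∣-respʳ refl p = p

∑-∣ : ∀ {k} n (f : Vector) → (∀ i → i ℕ.< n → k ∣ f i) → k ∣ ∑ n f
∑-∣ {k} zero f h = ∣0ℤ k
∑-∣ (suc n) f h = ∣m∣n⇒∣m+n (h 0 (s≤s z≤n)) (∑-∣ n (λ i → f (suc i)) (λ i i<n → h (suc i) (s≤s i<n)))

CongMod : ℕ → ℕ → Vector → Vector → Set
CongMod q n a b = ∀ t → t ℕ.< n → ℤ.+ q ∣ a t - b t

CongMod-⋆ : ∀ {q} n c (a b : Vector) (M : Matrix) → CongMod q n a b → CongMod q c (a ⋆⟨ n ⟩ M) (b ⋆⟨ n ⟩ M)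
CongMod-⋆ {q} n c a b M h t _ =
  ∣-respʳ (trans (∑-distrib-- n (λ i → a i * M i t) (λ i → b i * M i t)) refl)
     (∑-∣ n (λ i → a i * M i t - b i * M i t)
        (λ i i<n → ∣-respʳ (lem (a i) (b i) (M i t)) (∣m⇒∣m*n (M i t) (h i i<n))))
  where
  lem : ∀ x y z → (x - y) * z ≡ x * z - y * z
  lem = solve-∀

solvable⇒gcd∣ : ∀ (d q : ℕ) (w β : ℤ) → ℤ.+ q ∣ w * ℤ.+ d - β → ℤ.+ (gcd d q) ∣ β
solvable⇒gcd∣ d q w β h =
  ∣-respʳ (lem (w * ℤ.+ d) β) (∣m∣n⇒∣m-n (∣n⇒∣m*n w (∣ᵤ⇒∣ (G.gcd[m,n]∣m d q))) (∣-trans (∣ᵤ⇒∣ (G.gcd[m,n]∣n d q)) h))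
  where
  lem : ∀ a b → a - (a - b) ≡ b
  lem = solve-∀

open G.Bézout using (+-; -+)

gcd-bézout : ∀ d q → Σ ℤ λ x → Σ ℤ λ y → ℤ.+ (gcd d q) ≡ x * ℤ.+ d + y * ℤ.+ q
gcd-bézout d q with G.Bézout.identity (G.gcd-GCD d q)
... | +- x y eq = ℤ.+ x , - ℤ.+ y , trans (lem (ℤ.+ gcd d q) (ℤ.+ y) (ℤ.+ q)) (cong (_+ - ℤ.+ y * ℤ.+ q) eqℤ)
  where
  lem : ∀ g y q → g ≡ g + y * q + - y * q
  lem = solve-∀
  eqℤ : ℤ.+ gcd d q + ℤ.+ y * ℤ.+ q ≡ ℤ.+ x * ℤ.+ d
  eqℤ = trans (cong (ℤ.+ gcd d q +_) (sym (ℤP.pos-* y q)))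
               (trans (sym (ℤP.pos-+ (gcd d q) (y ℕ.* q))) (trans (cong ℤ.+_ eq) (ℤP.pos-* x d)))
... | -+ x y eq = - ℤ.+ x , ℤ.+ y , trans (lem (ℤ.+ gcd d q) (ℤ.+ x) (ℤ.+ d)) (cong (- ℤ.+ x * ℤ.+ d +_) eqℤ)
  where
  lem : ∀ g x d → g ≡ - x * d + (g + x * d)
  lem = solve-∀
  eqℤ : ℤ.+ gcd d q + ℤ.+ x * ℤ.+ d ≡ ℤ.+ y * ℤ.+ q
  eqℤ = trans (cong (ℤ.+ gcd d q +_) (sym (ℤP.pos-* x d)))
               (trans (sym (ℤP.pos-+ (gcd d q) (x ℕ.* d))) (trans (cong ℤ.+_ eq) (ℤP.pos-* y q)))

gcd∣⇒solvable : ∀ (d q : ℕ) (β : ℤ) → ℤ.+ (gcd d q) ∣ β → Σ ℤ λ w → ℤ.+ q ∣ w * ℤ.+ d - β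
gcd∣⇒solvable d q β (divides c refl) =
  let (x , y , g≡) = gcd-bézout d q in
  c * x , divides (- (c * y)) (trans (cong (λ g → c * x * ℤ.+ d - c * g) g≡) (lem c x (ℤ.+ d) y (ℤ.+ q)))
  where
  lem : ∀ c x d y q → c * x * d - c * (x * d + y * q) ≡ - (c * y) * q
  lem = solve-∀

gcd∣⇒∣* : ∀ (d q : ℕ) (w γ : ℤ) → ℤ.+ q ∣ w * ℤ.+ d → ℤ.+ (gcd d q) ∣ γ → ℤ.+ q ∣ w * γ
gcd∣⇒∣* d q w γ q∣wd g∣γ =
  let (a , q∣ad-γ) = gcd∣⇒solvable d q γ g∣γ in
  ∣-respʳ (lem w a (ℤ.+ d) γ) (∣m∣n⇒∣m-n (∣n⇒∣m*n a q∣wd) (∣n⇒∣m*n w q∣ad-γ))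
  where
  lem : ∀ w a d γ → a * (w * d) - w * (a * d - γ) ≡ w * γ
  lem = solve-∀

∣0-b⇒∣b : ∀ {k b} → k ∣ 0ℤ - b → k ∣ b
∣0-b⇒∣b {k} {b} p = ∣-respʳ (lem b) (∣m⇒∣-m p)
  where
  lem : ∀ b → - (0ℤ - b) ≡ b
  lem = solve-∀

gcd-absorb : ∀ d ρ q → d ℕD.∣ ρ → gcd d q ≡ gcd d (gcd ρ q)
gcd-absorb d ρ q h = trans (cong (λ x → gcd x q) (sym gdρ)) (G.gcd-assoc d ρ q)
  where
  gdρ : gcd d ρ ≡ d
  gdρ = G.GCD.unique (G.gcd-GCD d ρ) (G.GCD.is (ℕD.∣-refl , h) proj₁)

gcd-transport : ∀ d ρ q q' → d ℕD.∣ ρ → gcd ρ q ≡ gcd ρ q' → gcd d q ≡ gcd d q'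
gcd-transport d ρ q q' h eq = trans (gcd-absorb d ρ q h) (trans (cong (gcd d) eq) (sym (gcd-absorb d ρ q' h)))

InLattice : ℕ → ℕ → (ℕ → ℕ) → Vector → Vector → Set
InLattice K l d β y = Σ Vector λ x → Σ ℤ λ s → VecEq K y (λ t → scaleDiag l d x t + s * β t)

InLattice-cong : ∀ {K l d β y y'} → VecEq K y y' → InLattice K l d β y → InLattice K l d β y'
InLattice-cong h (x , s , eq) = x , s , λ t t<K → trans (sym (h t t<K)) (eq t t<K)

-- Conclusion: M' has rank l + 1, and any
-- q dividing all β_t with t ≥ l divides the largest elementary divisor e' of M'.
module LatticeExtension
  (R' K : ℕ) (M' : Matrix) (l' e' : ℕ) (H : SmithForm R' K M' l' e')
  (W W' : Matrix) (WW' : MatEq K K (W ⊙⟨ K ⟩ W') Id) (W'W : MatEq K K (W' ⊙⟨ K ⟩ W) Id)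
  (l : ℕ) (d : ℕ → ℕ) (E : ℕ) (E>0 : 0 ℕ.< E) (cE : ℕ → ℤ)
  (cE-spec : ∀ t → t ℕ.< l → ℤ.+ E ≡ cE t * ℤ.+ d t)
  (β : Vector) (t0 : ℕ) (l≤t0 : l ℕ.≤ t0) (t0<K : t0 ℕ.< K) (β≠0 : ¬ β t0 ≡ 0ℤ)
  (row⇒lattice : ∀ u → InLattice K l d β ((u ⋆⟨ R' ⟩ M') ⋆⟨ K ⟩ W))
  (lattice⇒row : ∀ x s → Σ Vector λ u → VecEq K ((u ⋆⟨ R' ⟩ M') ⋆⟨ K ⟩ W) (λ t → scaleDiag l d x t + s * β t))
  where

  open SmithForm H renaming (U to U₁; U' to U₁'; V to V₁; V' to V₁'; d to d')
  open SmithFormProperties H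

  N : ℤ
  N = β t0

  E≠0 : ¬ ℤ.+ E ≡ 0ℤ
  E≠0 eq = ℕP.<-irrefl (sym (ℤP.+-injective eq)) E>0

  e'≠0 : ¬ ℤ.+ e' ≡ 0ℤ
  e'≠0 eq = ℕP.<-irrefl (sym (ℤP.+-injective eq)) e>0

  l<K : l ℕ.< K
  l<K = ℕP.≤-<-trans l≤t0 t0<K

  Z Z' : Matrix
  Z = W' ⊙⟨ K ⟩ V₁
  Z' = V₁' ⊙⟨ K ⟩ W

  ZZ' : MatEq K K (Z ⊙⟨ K ⟩ Z') Id
  ZZ' = ⊙-conjugate-inverse K W' W V₁ V₁' W'W VV'

  Z'Z : MatEq K K (Z' ⊙⟨ K ⟩ Z) Id
  Z'Z = ⊙-conjugate-inverse K V₁' V₁ W W' V'V WW'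

  ZZ'-y : ∀ (y : Vector) → VecEq K ((y ⋆⟨ K ⟩ Z) ⋆⟨ K ⟩ Z') y
  ZZ'-y y = ⋆-inverseʳ K y Z Z' ZZ'

  WZ : ∀ (v : Vector) → VecEq K ((v ⋆⟨ K ⟩ W) ⋆⟨ K ⟩ Z) (v ⋆⟨ K ⟩ V₁)
  WZ v j j<K = trans (sym (⋆-assoc K K (v ⋆⟨ K ⟩ W) W' V₁ j)) (⋆-congˡ K V₁ (⋆-inverseʳ K v W W' WW') j)

  VZ' : ∀ (v : Vector) → VecEq K ((v ⋆⟨ K ⟩ V₁) ⋆⟨ K ⟩ Z') (v ⋆⟨ K ⟩ W)
  VZ' v j j<K = trans (sym (⋆-assoc K K (v ⋆⟨ K ⟩ V₁) V₁' W j)) (⋆-congˡ K W (⋆-inverseʳ K v V₁ V₁' VV') j)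

  -- y lies in the rational row space of M' W: its coordinates in the basis Z vanish
  -- beyond the rank.
  InRowSpace : Vector → Set
  InRowSpace y = ∀ s → l' ℕ.≤ s → s ℕ.< K → (y ⋆⟨ K ⟩ Z) s ≡ 0ℤ

  lattice-multiple⇒InRowSpace : ∀ (c : ℤ) (y : Vector) → ¬ c ≡ 0ℤ → InLattice K l d β (λ t → c * y t) → InRowSpace y
  lattice-multiple⇒InRowSpace c y c≢0 (x , s , eq) s' l'≤s' s'<K = *-cancelˡ-≡0 c ((y ⋆⟨ K ⟩ Z) s') c≢0 (
    begin
      c * (y ⋆⟨ K ⟩ Z) s'
    ≡⟨ sym (⋆-*ˡ K c y Z s') ⟩
      ((λ t → c * y t) ⋆⟨ K ⟩ Z) s'
    ≡⟨ ⋆-congˡ K Z (λ t t<K → trans (eq t t<K) (sym (proj₂ (lattice⇒row x s) t t<K))) s' ⟩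
      ((((proj₁ (lattice⇒row x s)) ⋆⟨ R' ⟩ M') ⋆⟨ K ⟩ W) ⋆⟨ K ⟩ Z) s'
    ≡⟨ WZ (proj₁ (lattice⇒row x s) ⋆⟨ R' ⟩ M') s' s'<K ⟩
      (((proj₁ (lattice⇒row x s)) ⋆⟨ R' ⟩ M') ⋆⟨ K ⟩ V₁) s'
    ≡⟨ ⋆A⋆V≡scale⋆U′ (proj₁ (lattice⇒row x s)) s' s'<K ⟩
      scaleDiag l' d' (proj₁ (lattice⇒row x s) ⋆⟨ R' ⟩ U₁') s'
    ≡⟨ scaleDiag-≥ l' d' (proj₁ (lattice⇒row x s) ⋆⟨ R' ⟩ U₁') s' l'≤s' ⟩
      0ℤ
    ∎)
    where open ≡-Reasoning

  InRowSpace⇒e′-multiple∈lattice : ∀ (y : Vector) → InRowSpace y → InLattice K l d β (λ t → ℤ.+ e' * y t)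
  InRowSpace⇒e′-multiple∈lattice y g = InLattice-cong {K} {l} {d} {β} {(u ⋆⟨ R' ⟩ M') ⋆⟨ K ⟩ W} {λ t → ℤ.+ e' * y t} eqv (row⇒lattice u)
    where
    c : ℕ → ℤ
    c = proj₁ e-quotients
    x : Vector
    x k = c k * (y ⋆⟨ K ⟩ Z) k
    u : Vector
    u = x ⋆⟨ R' ⟩ U₁
    dgx : VecEq K (scaleDiag l' d' x) (λ k → ℤ.+ e' * (y ⋆⟨ K ⟩ Z) k)
    dgx k k<K = cases (k ℕ.<? l')
      where
      lem : ∀ a b c → a * b * c ≡ a * c * b
      lem = solve-∀
      cases : Dec (k ℕ.< l') → scaleDiag l' d' x k ≡ ℤ.+ e' * (y ⋆⟨ K ⟩ Z) k
      cases (yes k<l') = trans (scaleDiag-< l' d' x k k<l')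
                     (trans (lem (c k) ((y ⋆⟨ K ⟩ Z) k) (ℤ.+ d' k)) (cong (_* (y ⋆⟨ K ⟩ Z) k) (sym (proj₂ e-quotients k k<l'))))
      cases (no k≮l') = trans (scaleDiag-≥ l' d' x k (ℕP.≮⇒≥ k≮l'))
                    (sym (trans (cong (ℤ.+ e' *_) (g k (ℕP.≮⇒≥ k≮l') k<K)) (ℤP.*-zeroʳ (ℤ.+ e'))))
    eqv : VecEq K ((u ⋆⟨ R' ⟩ M') ⋆⟨ K ⟩ W) (λ t → ℤ.+ e' * y t)
    eqv j j<K =
      begin
        ((u ⋆⟨ R' ⟩ M') ⋆⟨ K ⟩ W) j
      ≡⟨ sym (VZ' (u ⋆⟨ R' ⟩ M') j j<K) ⟩
        (((u ⋆⟨ R' ⟩ M') ⋆⟨ K ⟩ V₁) ⋆⟨ K ⟩ Z') j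
      ≡⟨ ⋆-congˡ K Z' (λ k k<K → trans (⋆U⋆A⋆V≡scale x k k<K) (dgx k k<K)) j ⟩
        ((λ k → ℤ.+ e' * (y ⋆⟨ K ⟩ Z) k) ⋆⟨ K ⟩ Z') j
      ≡⟨ ⋆-*ˡ K (ℤ.+ e') (y ⋆⟨ K ⟩ Z) Z' j ⟩
        ℤ.+ e' * ((y ⋆⟨ K ⟩ Z) ⋆⟨ K ⟩ Z') j
      ≡⟨ cong (ℤ.+ e' *_) (ZZ'-y y j j<K) ⟩
        ℤ.+ e' * y j
      ∎
      where open ≡-Reasoning

  lattice-multiple⇒proportional : ∀ (c : ℤ) (y : Vector) → ¬ c ≡ 0ℤ → InLattice K l d β (λ t → c * y t) →
        ∀ t → l ℕ.≤ t → t ℕ.< K → y t0 * β t ≡ N * y t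
  lattice-multiple⇒proportional c y c≢0 (x , s , eq) t l≤t t<K = *-cancelˡ-≢0 c (y t0 * β t) (N * y t) c≢0 (
    begin
      c * (y t0 * β t)
    ≡⟨ sym (ℤP.*-assoc c (y t0) (β t)) ⟩
      c * y t0 * β t
    ≡⟨ cong (_* β t) (trans (eq t0 t0<K) (cong (_+ s * β t0) (scaleDiag-≥ l d x t0 l≤t0))) ⟩
      (0ℤ + s * β t0) * β t
    ≡⟨ lem s (β t0) (β t) ⟩
      β t0 * (0ℤ + s * β t)
    ≡⟨ cong (β t0 *_) (sym (trans (eq t t<K) (cong (_+ s * β t) (scaleDiag-≥ l d x t l≤t)))) ⟩
      β t0 * (c * y t)
    ≡⟨ lem2 (β t0) c (y t) ⟩
      c * (β t0 * y t)
    ∎)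
    where
    open ≡-Reasoning
    lem : ∀ a b c → (0ℤ + a * b) * c ≡ b * (0ℤ + a * c)
    lem = solve-∀
    lem2 : ∀ a b c → a * (b * c) ≡ b * (a * c)
    lem2 = solve-∀

  InRowSpace⇒proportional : ∀ (y : Vector) → InRowSpace y → ∀ t → l ℕ.≤ t → t ℕ.< K → y t0 * β t ≡ N * y t
  InRowSpace⇒proportional y g = lattice-multiple⇒proportional (ℤ.+ e') y e'≠0 (InRowSpace⇒e′-multiple∈lattice y g)

  -- The rows F_0, …, F_l span the rational row space, and G is an N-scaled right inverse
  -- of F on it. Computing the trace of (F Z)(Z' G) in both orders gives (l+1) N = l' N.
  F : Matrix
  F i t = if i <ᵇ l then δ i t else (if t <ᵇ l then 0ℤ else β t)

  G : Matrix
  G t i = if i <ᵇ l then N * δ t i else δ t t0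

  F-head : ∀ i t → i ℕ.< l → F i t ≡ δ i t
  F-head i t i<l rewrite <⇒<ᵇ≡true i<l = refl

  F-last : ∀ t → F l t ≡ (if t <ᵇ l then 0ℤ else β t)
  F-last t rewrite ≤⇒<ᵇ≡false {l} {l} ℕP.≤-refl = refl

  G-head : ∀ t i → i ℕ.< l → G t i ≡ N * δ t i
  G-head t i i<l rewrite <⇒<ᵇ≡true i<l = refl

  G-last : ∀ t → G t l ≡ δ t t0
  G-last t rewrite ≤⇒<ᵇ≡false {l} {l} ℕP.≤-refl = refl

  ∑F-head : ∀ (v : Vector) t → ∑ l (λ i → v i * F i t) ≡ ∑ l (λ i → v i * δ i t)
  ∑F-head v t = ∑-cong l (λ i i<l → cong (v i *_) (F-head i t i<l))

  ⋆F-head : ∀ (v : Vector) t → t ℕ.< l → (v ⋆⟨ suc l ⟩ F) t ≡ v t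
  ⋆F-head v t t<l = begin
      (v ⋆⟨ suc l ⟩ F) t
    ≡⟨ ∑-suc l (λ i → v i * F i t) ⟩
      ∑ l (λ i → v i * F i t) + v l * F l t
    ≡⟨ cong₂ _+_ (trans (∑F-head v t) (∑-δʳ l t v t<l)) (cong (v l *_) (trans (F-last t) (cong (λ b → if b then 0ℤ else β t) (<⇒<ᵇ≡true t<l)))) ⟩
      v t + v l * 0ℤ
    ≡⟨ trans (cong (v t +_) (ℤP.*-zeroʳ (v l))) (ℤP.+-identityʳ (v t)) ⟩
      v t
    ∎
    where open ≡-Reasoning

  ⋆F-tail : ∀ (v : Vector) t → l ℕ.≤ t → (v ⋆⟨ suc l ⟩ F) t ≡ v l * β t
  ⋆F-tail v t l≤t = begin
      (v ⋆⟨ suc l ⟩ F) t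
    ≡⟨ ∑-suc l (λ i → v i * F i t) ⟩
      ∑ l (λ i → v i * F i t) + v l * F l t
    ≡⟨ cong₂ _+_ (trans (∑F-head v t) (∑-zero l (λ i i<l → trans (cong (v i *_) (δ-off i t (λ e → ℕP.<-irrefl e (ℕP.<-≤-trans i<l l≤t)))) (ℤP.*-zeroʳ (v i)))))
                 (cong (v l *_) (trans (F-last t) (cong (λ b → if b then 0ℤ else β t) (≤⇒<ᵇ≡false {t} {l} l≤t)))) ⟩
      0ℤ + v l * β t
    ≡⟨ ℤP.+-identityˡ _ ⟩
      v l * β t
    ∎
    where open ≡-Reasoning

  ⋆G-head : ∀ (y : Vector) i → i ℕ.< l → (y ⋆⟨ K ⟩ G) i ≡ N * y i
  ⋆G-head y i i<l = trans (∑-cong K (λ t _ → trans (cong (y t *_) (G-head t i i<l)) (lem (y t) N (δ t i))))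
                       (∑-δˡ K i (λ t → N * y t) (ℕP.<-trans i<l l<K))
    where
    lem : ∀ a b c → a * (b * c) ≡ c * (b * a)
    lem = solve-∀

  ⋆G-last : ∀ (y : Vector) → (y ⋆⟨ K ⟩ G) l ≡ y t0
  ⋆G-last y = trans (∑-cong K (λ t _ → cong (y t *_) (G-last t))) (∑-δʳ K t0 y t0<K)

  ⋆G⋆F≡N* : ∀ (y : Vector) → InRowSpace y → VecEq K ((y ⋆⟨ K ⟩ G) ⋆⟨ suc l ⟩ F) (λ t → N * y t)
  ⋆G⋆F≡N* y g t t<K with t ℕ.<? l
  ... | yes t<l = trans (⋆F-head (y ⋆⟨ K ⟩ G) t t<l) (⋆G-head y t t<l)
  ... | no t≮l = trans (⋆F-tail (y ⋆⟨ K ⟩ G) t (ℕP.≮⇒≥ t≮l)) (trans (cong (_* β t) (⋆G-last y)) (InRowSpace⇒proportional y g t (ℕP.≮⇒≥ t≮l) t<K))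

  InRowSpace-F : ∀ i → i ℕ.≤ l → InRowSpace (F i)
  InRowSpace-F i i≤l with ℕP.m≤n⇒m<n∨m≡n i≤l
  ... | inj₁ i<l = lattice-multiple⇒InRowSpace (ℤ.+ E) (F i) E≠0 (x , 0ℤ , eqv)
    where
    x : Vector
    x t = cE t * δ i t
    eqv : VecEq K (λ t → ℤ.+ E * F i t) (λ t → scaleDiag l d x t + 0ℤ * β t)
    eqv t t<K with t ℕ.<? l
    ... | yes t<l = begin
          ℤ.+ E * F i t
        ≡⟨ cong₂ _*_ (cE-spec t t<l) (F-head i t i<l) ⟩
          cE t * ℤ.+ d t * δ i t
        ≡⟨ lem (cE t) (ℤ.+ d t) (δ i t) (β t) ⟩
          cE t * δ i t * ℤ.+ d t + 0ℤ * β t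
        ≡⟨ cong (_+ 0ℤ * β t) (sym (scaleDiag-< l d x t t<l)) ⟩
          scaleDiag l d x t + 0ℤ * β t
        ∎
      where
      open ≡-Reasoning
      lem : ∀ a b c z → a * b * c ≡ a * c * b + 0ℤ * z
      lem = solve-∀
    ... | no t≮l = trans (cong (ℤ.+ E *_) (trans (F-head i t i<l) (δ-off i t (λ e → t≮l (subst (ℕ._< l) e i<l)))))
                  (trans (ℤP.*-zeroʳ (ℤ.+ E)) (sym (trans (cong₂ _+_ (scaleDiag-≥ l d x t (ℕP.≮⇒≥ t≮l)) (ℤP.*-zeroˡ (β t))) refl)))
  ... | inj₂ refl = lattice-multiple⇒InRowSpace (ℤ.+ E) (F l) E≠0 (x , ℤ.+ E , eqv)
    where
    x : Vector
    x t = - (cE t * β t)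
    eqv : VecEq K (λ t → ℤ.+ E * F l t) (λ t → scaleDiag l d x t + ℤ.+ E * β t)
    eqv t t<K with t ℕ.<? l
    ... | yes t<l = begin
          ℤ.+ E * F l t
        ≡⟨ cong (ℤ.+ E *_) (trans (F-last t) (cong (λ b → if b then 0ℤ else β t) (<⇒<ᵇ≡true t<l))) ⟩
          ℤ.+ E * 0ℤ
        ≡⟨ cong (λ z → z * 0ℤ) (cE-spec t t<l) ⟩
          cE t * ℤ.+ d t * 0ℤ
        ≡⟨ lem (cE t) (ℤ.+ d t) (β t) ⟩
          - (cE t * β t) * ℤ.+ d t + cE t * ℤ.+ d t * β t
        ≡⟨ cong₂ _+_ (sym (scaleDiag-< l d x t t<l)) (cong (_* β t) (sym (cE-spec t t<l))) ⟩
          scaleDiag l d x t + ℤ.+ E * β t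
        ∎
      where
      open ≡-Reasoning
      lem : ∀ a b c → a * b * 0ℤ ≡ - (a * c) * b + a * b * c
      lem = solve-∀
    ... | no t≮l = trans (cong (ℤ.+ E *_) (trans (F-last t) (cong (λ b → if b then 0ℤ else β t) (≤⇒<ᵇ≡false {t} {l} (ℕP.≮⇒≥ t≮l)))))
                  (sym (trans (cong (_+ ℤ.+ E * β t) (scaleDiag-≥ l d x t (ℕP.≮⇒≥ t≮l))) (ℤP.+-identityˡ _)))

  P Q : Matrix
  P = F ⊙⟨ K ⟩ Z
  Q = Z' ⊙⟨ K ⟩ G

  PQ-diagonal : ∀ i → i ℕ.< suc l → ∑ l' (λ s → P i s * Q s i) ≡ N
  PQ-diagonal i (s≤s i≤l) =
    begin
      ∑ l' (λ s → P i s * Q s i)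
    ≡⟨ sym (∑-truncate l' K (λ s → P i s * Q s i) l≤c
             (λ s a b → trans (cong (_* Q s i) (InRowSpace-F i i≤l s a b)) (ℤP.*-zeroˡ (Q s i)))) ⟩
      ((F i ⋆⟨ K ⟩ Z) ⋆⟨ K ⟩ (Z' ⊙⟨ K ⟩ G)) i
    ≡⟨ sym (⋆-assoc K K (F i ⋆⟨ K ⟩ Z) Z' G i) ⟩
      (((F i ⋆⟨ K ⟩ Z) ⋆⟨ K ⟩ Z') ⋆⟨ K ⟩ G) i
    ≡⟨ ⋆-congˡ K G (ZZ'-y (F i)) i ⟩
      (F i ⋆⟨ K ⟩ G) i
    ≡⟨ F⋆G-diagonal (ℕP.m≤n⇒m<n∨m≡n i≤l) ⟩
      N
    ∎
    where
    open ≡-Reasoning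
    F⋆G-diagonal : i ℕ.< l ⊎ i ≡ l → (F i ⋆⟨ K ⟩ G) i ≡ N
    F⋆G-diagonal (inj₁ i<l) = trans (⋆G-head (F i) i i<l) (trans (cong (N *_) (trans (F-head i i i<l) (δ-diag i))) (ℤP.*-identityʳ N))
    F⋆G-diagonal (inj₂ refl) = trans (⋆G-last (F l)) (trans (F-last t0) (cong (λ b → if b then 0ℤ else β t0) (≤⇒<ᵇ≡false {t0} {l} l≤t0)))

  QP-diagonal : ∀ s → s ℕ.< l' → ∑ (suc l) (λ i → Q s i * P i s) ≡ N
  QP-diagonal s s<l' =
    begin
      ∑ (suc l) (λ i → Q s i * P i s)
    ≡⟨ sym (⋆-assoc (suc l) K (y ⋆⟨ K ⟩ G) F Z s) ⟩
      (((y ⋆⟨ K ⟩ G) ⋆⟨ suc l ⟩ F) ⋆⟨ K ⟩ Z) s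
    ≡⟨ ⋆-congˡ K Z (⋆G⋆F≡N* y Z′-row∈RowSpace) s ⟩
      ((λ t → N * y t) ⋆⟨ K ⟩ Z) s
    ≡⟨ ⋆-*ˡ K N y Z s ⟩
      N * (y ⋆⟨ K ⟩ Z) s
    ≡⟨ cong (N *_) (trans (Z'Z s s s<K s<K) (δ-diag s)) ⟩
      N * 1ℤ
    ≡⟨ ℤP.*-identityʳ N ⟩
      N
    ∎
    where
    open ≡-Reasoning
    y : Vector
    y = Z' s
    s<K : s ℕ.< K
    s<K = ℕP.<-≤-trans s<l' l≤c
    Z′-row∈RowSpace : InRowSpace y
    Z′-row∈RowSpace s' a b = trans (Z'Z s s' s<K b) (δ-off s s' (λ e → ℕP.<-irrefl e (ℕP.<-≤-trans s<l' a)))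

  rank≡suc : l' ≡ suc l
  rank≡suc = sym (ℤP.+-injective (ℤP.*-cancelʳ-≡ (ℤ.+ suc l) (ℤ.+ l') N {{ℤ.≢-nonZero β≠0}}
    (begin
      ℤ.+ suc l * N
    ≡⟨ sym (∑-const (suc l) N) ⟩
      ∑ (suc l) (λ _ → N)
    ≡⟨ sym (∑-cong (suc l) PQ-diagonal) ⟩
      ∑ (suc l) (λ i → ∑ l' (λ s → P i s * Q s i))
    ≡⟨ ∑-swap (suc l) l' (λ i s → P i s * Q s i) ⟩
      ∑ l' (λ s → ∑ (suc l) (λ i → P i s * Q s i))
    ≡⟨ ∑-cong l' (λ s _ → ∑-cong (suc l) (λ i _ → ℤP.*-comm (P i s) (Q s i))) ⟩
      ∑ l' (λ s → ∑ (suc l) (λ i → Q s i * P i s))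
    ≡⟨ ∑-cong l' QP-diagonal ⟩
      ∑ l' (λ _ → N)
    ≡⟨ ∑-const l' N ⟩
      ℤ.+ l' * N
    ∎)))
    where open ≡-Reasoning

  module TailDivisibleBy (q : ℕ) (q>0 : 0 ℕ.< q) (q∣β : ∀ t → l ℕ.≤ t → t ℕ.< K → ℤ.+ q ∣ β t) where

    γ : Vector
    γ t with l ℕ.≤? t | t ℕ.<? K
    ... | yes l≤t | yes t<K = quotient (q∣β t l≤t t<K)
    ... | _       | _       = 0ℤ

    β≡γ*q : ∀ t → l ℕ.≤ t → t ℕ.< K → β t ≡ γ t * ℤ.+ q
    β≡γ*q t l≤t t<K with l ℕ.≤? t | t ℕ.<? K
    ... | yes l≤t′ | yes t<K′ = _∣_.equality (q∣β t l≤t′ t<K′)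
    ... | no l≰t   | _        = ⊥-elim (l≰t l≤t)
    ... | yes _    | no t≮K   = ⊥-elim (t≮K t<K)

    γ-head : ∀ t → t ℕ.< l → γ t ≡ 0ℤ
    γ-head t t<l with l ℕ.≤? t
    ... | yes l≤t = ⊥-elim (ℕP.<-irrefl refl (ℕP.<-≤-trans t<l l≤t))
    ... | no _    = refl

    Eq : ℤ
    Eq = ℤ.+ E * ℤ.+ q

    Eq≢0 : ¬ Eq ≡ 0ℤ
    Eq≢0 eq with ℤP.i*j≡0⇒i≡0∨j≡0 (ℤ.+ E) eq
    ... | inj₁ E≡0 = E≠0 E≡0
    ... | inj₂ q≡0 = ℕP.<-irrefl (sym (ℤP.+-injective q≡0)) q>0

    Eqγ∈lattice : InLattice K l d β (λ t → Eq * γ t)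
    Eqγ∈lattice = (λ t → - (cE t * β t)) , ℤ.+ E , eqv
      where
      open ≡-Reasoning
      x : Vector
      x t = - (cE t * β t)
      head : ∀ a b c → 0ℤ ≡ - (a * c) * b + a * b * c
      head = solve-∀
      tail : ∀ a b c → a * b * c ≡ 0ℤ + a * (c * b)
      tail = solve-∀
      eqv : VecEq K (λ t → Eq * γ t) (λ t → scaleDiag l d x t + ℤ.+ E * β t)
      eqv t t<K with t ℕ.<? l
      ... | yes t<l = begin
            Eq * γ t
          ≡⟨ trans (cong (Eq *_) (γ-head t t<l)) (ℤP.*-zeroʳ Eq) ⟩
            0ℤ
          ≡⟨ head (cE t) (ℤ.+ d t) (β t) ⟩
            - (cE t * β t) * ℤ.+ d t + cE t * ℤ.+ d t * β t
          ≡⟨ cong₂ _+_ (sym (scaleDiag-< l d x t t<l)) (cong (_* β t) (sym (cE-spec t t<l))) ⟩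
            scaleDiag l d x t + ℤ.+ E * β t
          ∎
      ... | no t≮l = begin
            Eq * γ t
          ≡⟨ tail (ℤ.+ E) (ℤ.+ q) (γ t) ⟩
            0ℤ + ℤ.+ E * (γ t * ℤ.+ q)
          ≡⟨ cong₂ _+_ (sym (scaleDiag-≥ l d x t (ℕP.≮⇒≥ t≮l))) (cong (ℤ.+ E *_) (sym (β≡γ*q t (ℕP.≮⇒≥ t≮l) t<K))) ⟩
            scaleDiag l d x t + ℤ.+ E * β t
          ∎

    q∣e′ : ℤ.+ q ∣ ℤ.+ e'
    q∣e′ = divides s (*-cancelˡ-≢0 (γ t0) _ _ γt0≢0 key)
      where
      open ≡-Reasoning
      e′γ∈lattice : InLattice K l d β (λ t → ℤ.+ e' * γ t)
      e′γ∈lattice = InRowSpace⇒e′-multiple∈lattice γ (lattice-multiple⇒InRowSpace Eq γ Eq≢0 Eqγ∈lattice)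
      x : Vector
      x = proj₁ e′γ∈lattice
      s : ℤ
      s = proj₁ (proj₂ e′γ∈lattice)
      γt0≢0 : ¬ γ t0 ≡ 0ℤ
      γt0≢0 eq = β≠0 (trans (β≡γ*q t0 l≤t0 t0<K) (trans (cong (_* ℤ.+ q) eq) (ℤP.*-zeroˡ (ℤ.+ q))))
      lem : ∀ a b c → 0ℤ + a * (b * c) ≡ b * (a * c)
      lem = solve-∀
      key : γ t0 * ℤ.+ e' ≡ γ t0 * (s * ℤ.+ q)
      key = begin
          γ t0 * ℤ.+ e'
        ≡⟨ ℤP.*-comm (γ t0) _ ⟩
          ℤ.+ e' * γ t0
        ≡⟨ proj₂ (proj₂ e′γ∈lattice) t0 t0<K ⟩
          scaleDiag l d x t0 + s * β t0
        ≡⟨ cong₂ _+_ (scaleDiag-≥ l d x t0 l≤t0) (cong (s *_) (β≡γ*q t0 l≤t0 t0<K)) ⟩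
          0ℤ + s * (γ t0 * ℤ.+ q)
        ≡⟨ lem s (γ t0) (ℤ.+ q) ⟩
          γ t0 * (s * ℤ.+ q)
        ∎

  tail-not-divisible : (q : ℕ) → 0 ℕ.< q → (l' ≡ suc l → e' ℕ.< q) →
                       ¬ (∀ t → l ℕ.≤ t → t ℕ.< K → ℤ.+ q ∣ β t)
  tail-not-divisible q q>0 rank-step⇒<q q∣β =
    ℕD.>⇒∤ {{ℕ.>-nonZero e>0}} (rank-step⇒<q rank≡suc) (∣⇒∣ᵤ (TailDivisibleBy.q∣e′ q q>0 q∣β))

module Solvability (m k : ℕ) (M : Matrix) (l e : ℕ) (H : SmithForm m k M l e)
          (Â : Matrix) (l' e' : ℕ) (H' : SmithForm (suc m) k Â l' e')
          (bJ : Vector) (Âtop : MatEq m k Â M) (Âbot : ∀ t → t ℕ.< k → Â m t ≡ bJ t)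
          (q q' : ℕ) (q>0 : 0 ℕ.< q) (rank-step⇒<q : l' ≡ suc l → e' ℕ.< q)
          (gcdEq : ∀ t → t ℕ.< l → gcd (SmithForm.d H t) q ≡ gcd (SmithForm.d H t) q')
  where
  open SmithForm H
  open SmithFormProperties H

  β : Vector
  β = bJ ⋆⟨ k ⟩ V

  ⋆Â : ∀ (u : Vector) t → t ℕ.< k → (u ⋆⟨ suc m ⟩ Â) t ≡ (u ⋆⟨ m ⟩ M) t + u m * bJ t
  ⋆Â u t t<k = trans (∑-suc m (λ i → u i * Â i t))
    (cong₂ _+_ (∑-cong m (λ i i<m → cong (u i *_) (Âtop i t i<m t<k))) (cong (u m *_) (Âbot t t<k)))

  ⋆Â⋆V : ∀ (u : Vector) t → t ℕ.< k → ((u ⋆⟨ suc m ⟩ Â) ⋆⟨ k ⟩ V) t ≡ ((u ⋆⟨ m ⟩ M) ⋆⟨ k ⟩ V) t + u m * β t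
  ⋆Â⋆V u t t<k = trans (⋆-congˡ k V (⋆Â u) t)
    (trans (⋆-distribʳ-+ k (u ⋆⟨ m ⟩ M) (λ i → u m * bJ i) V t) (cong ((((u ⋆⟨ m ⟩ M) ⋆⟨ k ⟩ V) t) +_) (⋆-*ˡ k (u m) bJ V t)))

  row⇒lattice : ∀ u → InLattice k l d β ((u ⋆⟨ suc m ⟩ Â) ⋆⟨ k ⟩ V)
  row⇒lattice u = (u ⋆⟨ m ⟩ U') , u m , λ t t<k → trans (⋆Â⋆V u t t<k) (cong (_+ u m * β t) (⋆A⋆V≡scale⋆U′ u t t<k))

  lattice⇒row : ∀ x s → Σ Vector λ u → VecEq k ((u ⋆⟨ suc m ⟩ Â) ⋆⟨ k ⟩ V) (λ t → scaleDiag l d x t + s * β t)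
  lattice⇒row x s = u , λ t t<k → trans (⋆Â⋆V u t t<k)
     (cong₂ _+_ (trans (⋆-congˡ k V (λ j _ → ⋆-congˡ m M ulo j) t) (⋆U⋆A⋆V≡scale x t t<k)) (cong (_* β t) um))
    where
    u : Vector
    u i = if i ≡ᵇ m then s else (x ⋆⟨ m ⟩ U) i
    ulo : VecEq m u (x ⋆⟨ m ⟩ U)
    ulo i i<m rewrite ≡ᵇ-≢ i m (λ e → ℕP.<-irrefl e i<m) = refl
    um : u m ≡ s
    um rewrite ≡ᵇ-refl m = refl

  tail-vanishes : (∀ t → l ℕ.≤ t → t ℕ.< k → ℤ.+ q ∣ β t) → ∀ t → l ℕ.≤ t → t ℕ.< k → β t ≡ 0ℤ
  tail-vanishes q∣β t l≤t t<k with β t ℤ.≟ 0ℤ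
  ... | yes β≡0 = β≡0
  ... | no β≢0 =
    ⊥-elim (LatticeExtension.tail-not-divisible (suc m) k Â l' e' H' V V' VV' V'V l d e e>0
              (proj₁ e-quotients) (proj₂ e-quotients) β t l≤t t<k β≢0 row⇒lattice lattice⇒row q q>0 rank-step⇒<q q∣β)

  transfer : Σ Vector (λ z → CongMod q k (z ⋆⟨ m ⟩ M) bJ) → Σ Vector (λ z → CongMod q' k (z ⋆⟨ m ⟩ M) bJ)
  transfer (z , zM≡b) = z′ , z′M≡b
    where
    w : Vector
    w = z ⋆⟨ m ⟩ U'
    wD≡β : CongMod q k (scaleDiag l d w) β
    wD≡β t t<k = ∣-respʳ (cong (_- β t) (⋆A⋆V≡scale⋆U′ z t t<k)) (CongMod-⋆ k k (z ⋆⟨ m ⟩ M) bJ V zM≡b t t<k)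
    β-tail≡0 : ∀ t → l ℕ.≤ t → t ℕ.< k → β t ≡ 0ℤ
    β-tail≡0 = tail-vanishes (λ t l≤t t<k → ∣0-b⇒∣b (∣-respʳ (cong (_- β t) (scaleDiag-≥ l d w t l≤t)) (wD≡β t t<k)))
    head-solvable : ∀ t → t ℕ.< l → Σ ℤ λ w′ → ℤ.+ q' ∣ w′ * ℤ.+ d t - β t
    head-solvable t t<l =
      gcd∣⇒solvable (d t) q' (β t)
        (subst (λ g → ℤ.+ g ∣ β t) (gcdEq t t<l)
           (solvable⇒gcd∣ (d t) q (w t) (β t)
              (∣-respʳ (cong (_- β t) (scaleDiag-< l d w t t<l)) (wD≡β t (ℕP.<-≤-trans t<l l≤c)))))
    choice : Σ (ℕ → ℤ) λ w′ → ∀ t → t ℕ.< l → ℤ.+ q' ∣ w′ t * ℤ.+ d t - β t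
    choice = finite-choice {P = λ t w′ → ℤ.+ q' ∣ w′ * ℤ.+ d t - β t} l 0ℤ head-solvable
    w′ : Vector
    w′ = proj₁ choice
    z′ : Vector
    z′ = w′ ⋆⟨ m ⟩ U
    w′D≡β : CongMod q' k (scaleDiag l d w′) β
    w′D≡β t t<k = by-cases (t ℕ.<? l)
      where
      by-cases : Dec (t ℕ.< l) → ℤ.+ q' ∣ scaleDiag l d w′ t - β t
      by-cases (yes t<l) = ∣-respʳ (cong (_- β t) (sym (scaleDiag-< l d w′ t t<l))) (proj₂ choice t t<l)
      by-cases (no t≮l) = ∣-respʳ (cong₂ _-_ (sym (scaleDiag-≥ l d w′ t (ℕP.≮⇒≥ t≮l))) (sym (β-tail≡0 t (ℕP.≮⇒≥ t≮l) t<k)))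
                                 (∣0ℤ (ℤ.+ q'))
    z′MV≡β : CongMod q' k ((z′ ⋆⟨ m ⟩ M) ⋆⟨ k ⟩ V) β
    z′MV≡β t t<k = ∣-respʳ (cong (_- β t) (sym (⋆U⋆A⋆V≡scale w′ t t<k))) (w′D≡β t t<k)
    z′M≡b : CongMod q' k (z′ ⋆⟨ m ⟩ M) bJ
    z′M≡b t t<k = ∣-respʳ (cong₂ _-_ (⋆-inverseʳ k (z′ ⋆⟨ m ⟩ M) V V' VV' t t<k) (⋆-inverseʳ k bJ V V' VV' t t<k))
                          (CongMod-⋆ k k ((z′ ⋆⟨ m ⟩ M) ⋆⟨ k ⟩ V) β V' z′MV≡β t t<k)

dot : ℕ → Vector → Vector → ℤ
dot m z c = ∑ m (λ i → z i * c i)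

Implies : ℕ → ℕ → Matrix → Vector → ℕ → Set
Implies m k M ĉ q = ∀ (z : Vector) → CongMod q k (z ⋆⟨ m ⟩ M) (λ _ → 0ℤ) → ℤ.+ q ∣ dot m z ĉ

-- M2 plays the role of the transpose of M with the column ĉ adjoined: its row
-- combinations are exactly the y Mᵀ + s ĉ.
module Implication (m k : ℕ) (M : Matrix) (l e : ℕ) (H : SmithForm m k M l e) (ĉ : Vector)
          (k' : ℕ) (M2 : Matrix) (l2 e2 : ℕ) (H2 : SmithForm k' m M2 l2 e2)
          (split-row : ∀ u → Σ Vector λ y → Σ ℤ λ s → VecEq m (u ⋆⟨ k' ⟩ M2) (λ i → (y ⋆⟨ k ⟩ (M ᵀ)) i + s * ĉ i))
          (join-row : ∀ y s → Σ Vector λ u → VecEq m (u ⋆⟨ k' ⟩ M2) (λ i → (y ⋆⟨ k ⟩ (M ᵀ)) i + s * ĉ i))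
          (q q' : ℕ) (q>0 : 0 ℕ.< q) (rank-step⇒<q : l2 ≡ suc l → e2 ℕ.< q)
          (gcdEq : ∀ t → t ℕ.< l → gcd (SmithForm.d H t) q ≡ gcd (SmithForm.d H t) q')
  where
  open SmithForm H
  open SmithFormProperties H
  module TT = SmithForm (SmithForm-ᵀ H)
  module TL = SmithFormProperties (SmithForm-ᵀ H)

  γ : Vector
  γ = ĉ ⋆⟨ m ⟩ (U ᵀ)

  dot-⋆U : ∀ (x : Vector) → dot m (x ⋆⟨ m ⟩ U) ĉ ≡ dot m x γ
  dot-⋆U x = trans (⋆-assoc m m x U (λ i _ → ĉ i) 0)
                 (∑-cong m (λ s _ → cong (x s *_) (∑-cong m (λ i _ → ℤP.*-comm (U s i) (ĉ i)))))

  scaleDiag≡0⇒⋆U⋆A≡0 : ∀ (Qn : ℕ) (x : Vector) → CongMod Qn k (scaleDiag l d x) (λ _ → 0ℤ) →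
            CongMod Qn k ((x ⋆⟨ m ⟩ U) ⋆⟨ m ⟩ M) (λ _ → 0ℤ)
  scaleDiag≡0⇒⋆U⋆A≡0 Qn x h t t<k =
    ∣-respʳ (cong₂ _-_ (⋆-inverseʳ k ((x ⋆⟨ m ⟩ U) ⋆⟨ m ⟩ M) V V' VV' t t<k) (∑-zero k (λ i _ → ℤP.*-zeroˡ (V' i t))))
       (CongMod-⋆ k k (((x ⋆⟨ m ⟩ U) ⋆⟨ m ⟩ M) ⋆⟨ k ⟩ V) (λ _ → 0ℤ) V'
          (λ t t<k → ∣-respʳ (cong (_- 0ℤ) (sym (⋆U⋆A⋆V≡scale x t t<k))) (h t t<k)) t t<k)

  unit-multiple-annihilated : ∀ Q (a : ℤ) s → (s ℕ.< l → ℤ.+ Q ∣ a * ℤ.+ d s) →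
                              CongMod Q k (scaleDiag l d (λ i → a * δ i s)) (λ _ → 0ℤ)
  unit-multiple-annihilated Q a s h t t<k with t ℕ.<? l
  ... | no t≮l = ∣-respʳ (cong (_- 0ℤ) (sym (scaleDiag-≥ l d (λ i → a * δ i s) t (ℕP.≮⇒≥ t≮l)))) (∣0ℤ (ℤ.+ Q))
  ... | yes t<l with t ℕ.≟ s
  ...   | yes refl = ∣-respʳ (sym eq) (h t<l)
    where
    eq : a * δ t t * diagVec l d t - 0ℤ ≡ a * ℤ.+ d t
    eq = trans (ℤP.+-identityʳ _) (trans (cong₂ (λ u v → a * u * v) (δ-diag t) (diagVec-< l d t t<l))
                                         (cong (_* ℤ.+ d t) (ℤP.*-identityʳ a)))
  ...   | no t≢s = ∣-respʳ (sym eq) (∣0ℤ (ℤ.+ Q))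
    where
    lem : ∀ a b → a * 0ℤ * b ≡ 0ℤ
    lem = solve-∀
    eq : a * δ t s * diagVec l d t - 0ℤ ≡ 0ℤ
    eq = trans (ℤP.+-identityʳ _) (trans (cong (λ u → a * u * diagVec l d t) (δ-off t s t≢s)) (lem a _))

  dot-unit-multiple : ∀ (a : ℤ) s → s ℕ.< m → dot m ((λ i → a * δ i s) ⋆⟨ m ⟩ U) ĉ ≡ a * γ s
  dot-unit-multiple a s s<m =
    trans (dot-⋆U (λ i → a * δ i s))
          (trans (∑-cong m (λ i _ → ℤP.*-assoc a (δ i s) (γ i)))
                 (trans (∑-*ˡ m a (λ i → δ i s * γ i)) (cong (a *_) (∑-δˡ m s γ s<m))))

  Implies⇒∣*γ : ∀ {Q} → Implies m k M ĉ Q → ∀ (a : ℤ) s → s ℕ.< m →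
                (s ℕ.< l → ℤ.+ Q ∣ a * ℤ.+ d s) → ℤ.+ Q ∣ a * γ s
  Implies⇒∣*γ {Q} implies a s s<m h =
    ∣-respʳ (dot-unit-multiple a s s<m)
            (implies ((λ i → a * δ i s) ⋆⟨ m ⟩ U) (scaleDiag≡0⇒⋆U⋆A≡0 Q (λ i → a * δ i s) (unit-multiple-annihilated Q a s h)))

  Implies⇒q∣tail : Implies m k M ĉ q → ∀ s → l ℕ.≤ s → s ℕ.< m → ℤ.+ q ∣ γ s
  Implies⇒q∣tail implies s l≤s s<m =
    ∣-respʳ (ℤP.*-identityˡ (γ s)) (Implies⇒∣*γ {q} implies 1ℤ s s<m (λ s<l → ⊥-elim (ℕP.<⇒≱ s<l l≤s)))

  Implies⇒gcd∣head : Implies m k M ĉ q → ∀ s → s ℕ.< l → ℤ.+ (gcd (d s) q) ∣ γ s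
  Implies⇒gcd∣head implies s s<l with G.gcd[m,n]∣n (d s) q | G.gcd[m,n]∣m (d s) q
  ... | ℕD.divides μ q≡μg | ℕD.divides ν ds≡νg =
    ∣*-cancelˡ (ℤ.+ μ) {{ℤ.≢-nonZero μ≢0}}
      (subst (_∣ ℤ.+ μ * γ s) qZ (Implies⇒∣*γ {q} implies (ℤ.+ μ) s (ℕP.<-≤-trans s<l l≤r) (λ _ → divides (ℤ.+ ν) μd≡νq)))
    where
    g : ℕ
    g = gcd (d s) q
    μ≢0 : ¬ ℤ.+ μ ≡ 0ℤ
    μ≢0 eq = ℕP.<-irrefl (sym (trans q≡μg (cong (ℕ._* g) (ℤP.+-injective eq)))) q>0
    qZ : ℤ.+ q ≡ ℤ.+ μ * ℤ.+ g
    qZ = trans (cong ℤ.+_ q≡μg) (ℤP.pos-* μ g)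
    lem : ∀ a b c → a * (b * c) ≡ b * (a * c)
    lem = solve-∀
    μd≡νq : ℤ.+ μ * ℤ.+ d s ≡ ℤ.+ ν * ℤ.+ q
    μd≡νq = trans (cong (ℤ.+ μ *_) (trans (cong ℤ.+_ ds≡νg) (ℤP.pos-* ν g)))
                  (trans (lem (ℤ.+ μ) (ℤ.+ ν) (ℤ.+ g)) (cong (ℤ.+ ν *_) (sym qZ)))

  tail∧gcd⇒Implies : (∀ s → l ℕ.≤ s → s ℕ.< m → γ s ≡ 0ℤ) → (∀ s → s ℕ.< l → ℤ.+ (gcd (d s) q') ∣ γ s) →
            Implies m k M ĉ q'
  tail∧gcd⇒Implies hiZ lo z hz = ∣-respʳ (sym eqd) (∑-∣ m (λ s → w s * γ s) term)
    where
    w : Vector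
    w = z ⋆⟨ m ⟩ U'
    eqd : dot m z ĉ ≡ dot m w γ
    eqd = trans (∑-cong m (λ i i<m → cong (_* ĉ i) (sym (⋆-inverseʳ m z U' U U'U i i<m)))) (dot-⋆U w)
    hw : CongMod q' k (scaleDiag l d w) (λ _ → 0ℤ)
    hw t t<k = ∣-respʳ (cong₂ _-_ (⋆A⋆V≡scale⋆U′ z t t<k) (∑-zero k (λ i _ → ℤP.*-zeroˡ (V i t))))
                  (CongMod-⋆ k k (z ⋆⟨ m ⟩ M) (λ _ → 0ℤ) V hz t t<k)
    term : ∀ s → s ℕ.< m → ℤ.+ q' ∣ w s * γ s
    term s s<m with s ℕ.<? l
    ... | yes s<l = gcd∣⇒∣* (d s) q' (w s) (γ s)
                      (∣-respʳ (trans (ℤP.+-identityʳ _) (scaleDiag-< l d w s s<l)) (hw s (ℕP.<-≤-trans s<l l≤c))) (lo s s<l)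
    ... | no s≮l = ∣-respʳ (sym (trans (cong (w s *_) (hiZ s (ℕP.≮⇒≥ s≮l) s<m)) (ℤP.*-zeroʳ (w s)))) (∣0ℤ (ℤ.+ q'))

  row⇒lattice : ∀ u → InLattice m l d γ ((u ⋆⟨ k' ⟩ M2) ⋆⟨ m ⟩ (U ᵀ))
  row⇒lattice u with split-row u
  ... | y , s , eq = (y ⋆⟨ k ⟩ (V' ᵀ)) , s , λ t t<m →
        trans (⋆-congˡ m (U ᵀ) eq t)
        (trans (⋆-distribʳ-+ m (y ⋆⟨ k ⟩ (M ᵀ)) (λ i → s * ĉ i) (U ᵀ) t)
        (cong₂ _+_ (TL.⋆A⋆V≡scale⋆U′ y t t<m) (⋆-*ˡ m s ĉ (U ᵀ) t)))

  lattice⇒row : ∀ x s → Σ Vector λ u → VecEq m ((u ⋆⟨ k' ⟩ M2) ⋆⟨ m ⟩ (U ᵀ)) (λ t → scaleDiag l d x t + s * γ t)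
  lattice⇒row x s with join-row (x ⋆⟨ k ⟩ (V ᵀ)) s
  ... | u , eq = u , λ t t<m →
        trans (⋆-congˡ m (U ᵀ) eq t)
        (trans (⋆-distribʳ-+ m ((x ⋆⟨ k ⟩ (V ᵀ)) ⋆⟨ k ⟩ (M ᵀ)) (λ i → s * ĉ i) (U ᵀ) t)
        (cong₂ _+_ (TL.⋆U⋆A⋆V≡scale x t t<m) (⋆-*ˡ m s ĉ (U ᵀ) t)))

  tail-vanishes : (∀ s → l ℕ.≤ s → s ℕ.< m → ℤ.+ q ∣ γ s) → ∀ s → l ℕ.≤ s → s ℕ.< m → γ s ≡ 0ℤ
  tail-vanishes q∣γ t l≤t t<m with γ t ℤ.≟ 0ℤ
  ... | yes γ≡0 = γ≡0
  ... | no γ≢0 =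
    ⊥-elim (LatticeExtension.tail-not-divisible k' m M2 l2 e2 H2 (U ᵀ) (U' ᵀ) TT.VV' TT.V'V l d e e>0
              (proj₁ e-quotients) (proj₂ e-quotients) γ t l≤t t<m γ≢0 row⇒lattice lattice⇒row q q>0 rank-step⇒<q q∣γ)

  transfer-Implies : Implies m k M ĉ q → Implies m k M ĉ q'
  transfer-Implies implies = tail∧gcd⇒Implies (tail-vanishes (Implies⇒q∣tail implies)) (λ s s<l → subst (λ g → ℤ.+ g ∣ γ s) (gcdEq s s<l) (Implies⇒gcd∣head implies s s<l))

sel-∈ : ∀ {n} (J : Subset n) t → T (lookup J (sel J t))
sel-∈ (true ∷ J) zero = tt
sel-∈ (true ∷ J) (suc t) = sel-∈ J t
sel-∈ (false ∷ J) t = sel-∈ J t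

∈⇒sel : ∀ {n} (J : Subset n) j → T (lookup J j) → Σ (Fin (card J)) λ t → sel J t ≡ j
∈⇒sel (true ∷ J) zero _ = zero , refl
∈⇒sel (true ∷ J) (suc j) h with ∈⇒sel J j h
... | t , e = suc t , cong suc e
∈⇒sel (false ∷ J) (suc j) h with ∈⇒sel J j h
... | t , e = t , cong suc e

empty⇒∉ : ∀ {n} (J : Subset n) → nonemptyᵇ J ≡ false → ∀ j → ¬ T (lookup J j)
empty⇒∉ (false ∷ J) h zero ()
empty⇒∉ (false ∷ J) h (suc j) = empty⇒∉ J h j

∈⇒nonempty : ∀ {n} (J : Subset n) j → T (lookup J j) → T (nonemptyᵇ J)
∈⇒nonempty (true ∷ J) j _ = tt
∈⇒nonempty (false ∷ J) (suc j) h = ∈⇒nonempty J j h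

T⇒≡true : ∀ {b} → T b → b ≡ true
T⇒≡true {true} _ = refl

lookup-insert : ∀ {n} (j : Fin n) (J : Subset n) → lookup (insert j J) j ≡ true
lookup-insert j J = VP.lookup∘update j J true

lookup-insert-≢ : ∀ {n} (j j' : Fin n) (J : Subset n) → ¬ j ≡ j' → lookup (insert j J) j' ≡ lookup J j'
lookup-insert-≢ j j' J ne = VP.lookup∘update′ (λ e → ne (sym e)) J true

spread : ∀ {n} (J : Subset n) → (Fin (card J) → ℤ) → Fin n → ℤ
spread (true ∷ J) u zero = u zero
spread (true ∷ J) u (suc j) = spread J (λ t → u (suc t)) j
spread (false ∷ J) u zero = 0ℤ
spread (false ∷ J) u (suc j) = spread J u j

mask : ∀ {n} (J : Subset n) → (Fin n → ℤ) → Fin n → ℤ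
mask J y j = if lookup J j then y j else 0ℤ

Σℤ-sel-spread : ∀ {n} (J : Subset n) (u : Fin (card J) → ℤ) (f : Fin n → ℤ) →
     Σℤ (λ t → u t * f (sel J t)) ≡ Σℤ (λ j → spread J u j * f j)
Σℤ-sel-spread [] u f = refl
Σℤ-sel-spread (true ∷ J) u f = cong (u zero * f zero +_) (Σℤ-sel-spread J (λ t → u (suc t)) (λ j → f (suc j)))
Σℤ-sel-spread (false ∷ J) u f = trans (Σℤ-sel-spread J u (λ j → f (suc j))) (sym (ℤP.+-identityˡ _))

Σℤ-sel-mask : ∀ {n} (J : Subset n) (y f : Fin n → ℤ) →
     Σℤ (λ t → y (sel J t) * f (sel J t)) ≡ Σℤ (λ j → mask J y j * f j)
Σℤ-sel-mask [] y f = refl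
Σℤ-sel-mask (true ∷ J) y f = cong (y zero * f zero +_) (Σℤ-sel-mask J (λ j → y (suc j)) (λ j → f (suc j)))
Σℤ-sel-mask (false ∷ J) y f = trans (Σℤ-sel-mask J (λ j → y (suc j)) (λ j → f (suc j))) (sym (ℤP.+-identityˡ _))

spread-off : ∀ {n} (J : Subset n) u j → lookup J j ≡ false → spread J u j ≡ 0ℤ
spread-off (true ∷ J) u (suc j) h = spread-off J (λ t → u (suc t)) j h
spread-off (false ∷ J) u zero h = refl
spread-off (false ∷ J) u (suc j) h = spread-off J u j h

spread-mask : ∀ {n} (J : Subset n) u j → mask J (spread J u) j ≡ spread J u j
spread-mask J u j with lookup J j in eq
... | true = refl
... | false = sym (spread-off J u j eq)

δᶠ : ∀ {n} → Fin n → Fin n → ℤ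
δᶠ i j = if toℕ i ≡ᵇ toℕ j then 1ℤ else 0ℤ

δᶠ-diag : ∀ {n} (i : Fin n) → δᶠ i i ≡ 1ℤ
δᶠ-diag i rewrite T⇒≡true (ℕP.≡⇒≡ᵇ (toℕ i) (toℕ i) refl) = refl

δᶠ-off : ∀ {n} (i j : Fin n) → ¬ i ≡ j → δᶠ i j ≡ 0ℤ
δᶠ-off i j ne with toℕ i ≡ᵇ toℕ j in eq
... | true = ⊥-elim (ne (FP.toℕ-injective (ℕP.≡ᵇ⇒≡ (toℕ i) (toℕ j) (subst T (sym eq) tt))))
... | false = refl

Σℤ-+ : ∀ {n} (f g : Fin n → ℤ) → Σℤ (λ j → f j + g j) ≡ Σℤ f + Σℤ g
Σℤ-+ {zero} f g = refl
Σℤ-+ {suc n} f g rewrite Σℤ-+ (λ j → f (suc j)) (λ j → g (suc j)) =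
  lem (f zero) (g zero) (Σℤ (λ j → f (suc j))) (Σℤ (λ j → g (suc j)))
  where
  lem : ∀ a b c d → a + b + (c + d) ≡ a + c + (b + d)
  lem = solve-∀

Σℤ-cong : ∀ {n} {f g : Fin n → ℤ} → (∀ j → f j ≡ g j) → Σℤ f ≡ Σℤ g
Σℤ-cong {zero} h = refl
Σℤ-cong {suc n} h = cong₂ _+_ (h zero) (Σℤ-cong (λ j → h (suc j)))

Σℤ-zero : ∀ {n} {f : Fin n → ℤ} → (∀ j → f j ≡ 0ℤ) → Σℤ f ≡ 0ℤ
Σℤ-zero {zero} h = refl
Σℤ-zero {suc n} h rewrite h zero | Σℤ-zero {n} (λ j → h (suc j)) = refl

Σℤ-δᶠ : ∀ {n} (j0 : Fin n) (g : Fin n → ℤ) → Σℤ (λ j → δᶠ j j0 * g j) ≡ g j0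
Σℤ-δᶠ {suc n} zero g = trans (cong₂ _+_ (ℤP.*-identityˡ (g zero)) (Σℤ-zero (λ j → ℤP.*-zeroˡ (g (suc j))))) (ℤP.+-identityʳ _)
Σℤ-δᶠ {suc n} (suc j0) g = trans (cong₂ _+_ (ℤP.*-zeroˡ (g zero)) (Σℤ-δᶠ j0 (λ j → g (suc j)))) (ℤP.+-identityˡ _)

mask-insert : ∀ {n} (j0 : Fin n) (J : Subset n) → lookup J j0 ≡ false → ∀ (Y : Fin n → ℤ) j →
           mask (insert j0 J) Y j ≡ mask J Y j + δᶠ j j0 * Y j0
mask-insert j0 J off Y j with j F.≟ j0
... | yes refl rewrite lookup-insert j0 J | off | δᶠ-diag j0 = sym (trans (ℤP.+-identityˡ _) (ℤP.*-identityˡ _))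
... | no ne rewrite lookup-insert-≢ j0 j J (λ e → ne (sym e)) | δᶠ-off j j0 ne =
  sym (trans (cong (mask J Y j +_) (ℤP.*-zeroˡ (Y j0))) (ℤP.+-identityʳ _))

module InsertColumn {n} (j0 : Fin n) (J : Subset n) (off : lookup J j0 ≡ false) where
  J' : Subset n
  J' = insert j0 J

  Σℤ-mask-insert : ∀ (Y f : Fin n → ℤ) → Σℤ (λ j → mask J' Y j * f j) ≡ Σℤ (λ t → Y (sel J t) * f (sel J t)) + Y j0 * f j0
  Σℤ-mask-insert Y f = begin
      Σℤ (λ j → mask J' Y j * f j)
    ≡⟨ Σℤ-cong (λ j → trans (cong (_* f j) (mask-insert j0 J off Y j)) (ℤP.*-distribʳ-+ (f j) (mask J Y j) (δᶠ j j0 * Y j0))) ⟩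
      Σℤ (λ j → mask J Y j * f j + δᶠ j j0 * Y j0 * f j)
    ≡⟨ Σℤ-+ (λ j → mask J Y j * f j) (λ j → δᶠ j j0 * Y j0 * f j) ⟩
      Σℤ (λ j → mask J Y j * f j) + Σℤ (λ j → δᶠ j j0 * Y j0 * f j)
    ≡⟨ cong₂ _+_ (sym (Σℤ-sel-mask J Y f)) (trans (Σℤ-cong (λ j → ℤP.*-assoc (δᶠ j j0) (Y j0) (f j))) (Σℤ-δᶠ j0 (λ j → Y j0 * f j))) ⟩
      Σℤ (λ t → Y (sel J t) * f (sel J t)) + Y j0 * f j0
    ∎
    where open ≡-Reasoning

  split-combination : ∀ (u : Fin (card J') → ℤ) → Σ (Fin (card J) → ℤ) λ y → Σ ℤ λ s → ∀ (f : Fin n → ℤ) →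
         Σℤ (λ t → u t * f (sel J' t)) ≡ Σℤ (λ t → y t * f (sel J t)) + s * f j0
  split-combination u = (λ t → Y (sel J t)) , Y j0 , λ f →
    trans (Σℤ-sel-spread J' u f) (trans (sym (Σℤ-cong (λ j → cong (_* f j) (spread-mask J' u j)))) (Σℤ-mask-insert Y f))
    where
    Y = spread J' u

  join-combination : ∀ (y : Fin (card J) → ℤ) (s : ℤ) → Σ (Fin (card J') → ℤ) λ u → ∀ (f : Fin n → ℤ) →
         Σℤ (λ t → u t * f (sel J' t)) ≡ Σℤ (λ t → y t * f (sel J t)) + s * f j0
  join-combination y s = (λ t → Y (sel J' t)) , λ f →
    trans (Σℤ-sel-mask J' Y f) (trans (Σℤ-mask-insert Y f) (cong₂ _+_ (part1 f) (cong (_* f j0) Yj0)))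
    where
    Y : Fin n → ℤ
    Y j = spread J y j + s * δᶠ j j0
    Yj0 : Y j0 ≡ s
    Yj0 rewrite spread-off J y j0 off | δᶠ-diag j0 = trans (ℤP.+-identityˡ _) (ℤP.*-identityʳ s)
    mY : ∀ j → mask J Y j ≡ spread J y j
    mY j with lookup J j in eq
    ... | true with j F.≟ j0
    ...   | yes refl = ⊥-elim (subst T (trans (sym eq) off) tt)
    ...   | no ne = trans (cong (spread J y j +_) (trans (cong (s *_) (δᶠ-off j j0 ne)) (ℤP.*-zeroʳ s))) (ℤP.+-identityʳ _)
    mY j | false = sym (spread-off J y j eq)
    part1 : ∀ f → Σℤ (λ t → Y (sel J t) * f (sel J t)) ≡ Σℤ (λ t → y t * f (sel J t))
    part1 f = trans (Σℤ-sel-mask J Y f) (trans (Σℤ-cong (λ j → cong (_* f j) (mY j))) (sym (Σℤ-sel-spread J y f)))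

allSubsets-∈ : ∀ {n} (J : Subset n) → J ∈L allSubsets n
allSubsets-∈ [] = here refl
allSubsets-∈ {suc n} (true ∷ J) = ∈-++⁺ˡ (∈-map⁺ (true ∷_) (allSubsets-∈ J))
allSubsets-∈ {suc n} (false ∷ J) = ∈-++⁺ʳ (map (true ∷_) (allSubsets n)) (∈-map⁺ (false ∷_) (allSubsets-∈ J))

allFin-∈ : ∀ {n} (j : Fin n) → j ∈L allFin n
allFin-∈ zero = here refl
allFin-∈ (suc j) = there (∈-map⁺ suc (allFin-∈ j))

maxL-≥ : ∀ {x xs} → x ∈L xs → x ℕ.≤ maxL xs
maxL-≥ {x} {_ ∷ xs} (here refl) = ℕP.m≤m⊔n x (maxL xs)
maxL-≥ {x} {y ∷ xs} (there p) = ℕP.≤-trans (maxL-≥ p) (ℕP.m≤n⊔m y (maxL xs))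

lcmL-∣ : ∀ {x xs} → x ∈L xs → x ℕD.∣ lcmL xs
lcmL-∣ {x} {_ ∷ xs} (here refl) = m∣lcm[m,n] x (lcmL xs)
lcmL-∣ {x} {y ∷ xs} (there p) = ℕD.∣-trans (lcmL-∣ p) (n∣lcm[m,n] y (lcmL xs))

concatMap-∈ : ∀ {A B : Set} (f : A → List B) {a : A} {xs : List A} {x : B} → a ∈L xs → x ∈L f a → x ∈L concatMap f xs
concatMap-∈ f {xs = _ ∷ xs} (here refl) p = ∈-++⁺ˡ p
concatMap-∈ f {xs = y ∷ xs} (there q) p = ∈-++⁺ʳ (f y) (concatMap-∈ f q p)

if-∈ : ∀ {B : Set} {c : Bool} (x : B) → T c → x ∈L (if c then x ∷ [] else [])
if-∈ {c = true} x _ = here refl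

T-∧-intro : ∀ {a b} → T a → T b → T (a ∧ b)
T-∧-intro {true} {true} _ _ = tt

gcdL-greatest : ∀ {A : Set} (f : A → ℕ) q (xs : List A) → (∀ a → q ℕD.∣ f a) → q ℕD.∣ foldr gcd 0 (map f xs)
gcdL-greatest f q [] h = q ℕD.∣0
gcdL-greatest f q (x ∷ xs) h = G.gcd-greatest (h x) (gcdL-greatest f q xs h)

gcdL-zero : ∀ {A : Set} (f : A → ℕ) (xs : List A) a → a ∈L xs → foldr gcd 0 (map f xs) ≡ 0 → f a ≡ 0
gcdL-zero f (x ∷ xs) a (here refl) eq = G.gcd[m,n]≡0⇒m≡0 eq
gcdL-zero f (x ∷ xs) a (there p) eq = gcdL-zero f xs a p (G.gcd[m,n]≡0⇒n≡0 (f x) eq)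

extend-snocF-< : ∀ m (f : Fin m → ℤ) x i → i ℕ.< m → extend {suc m} (snocF f x) i ≡ extend f i
extend-snocF-< (suc m) f x zero _ = refl
extend-snocF-< (suc m) f x (suc i) (s≤s p) = extend-snocF-< m (λ a → f (suc a)) x i p

extend-snocF-last : ∀ m (f : Fin m → ℤ) x → extend {suc m} (snocF f x) m ≡ x
extend-snocF-last zero f x = refl
extend-snocF-last (suc m) f x = extend-snocF-last m (λ a → f (suc a)) x

extend-restrict : ∀ {k} (v : Vector) → VecEq k (extend {k} (λ a → v (toℕ a))) v
extend-restrict {k} v = below-by-Fin {P = λ i → extend {k} (λ a → v (toℕ a)) i ≡ v i} (λ a → extend-toℕ (λ a → v (toℕ a)) a)

extend-+ : ∀ {n} (f g : Fin n → ℤ) i → extend (λ a → f a + g a) i ≡ extend f i + extend g i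
extend-+ {zero} f g i = refl
extend-+ {suc n} f g zero = refl
extend-+ {suc n} f g (suc i) = extend-+ (λ a → f (suc a)) (λ a → g (suc a)) i

∑-extend≡Σℤ : ∀ {k} (v : Vector) (g : Fin k → ℤ) → ∑ k (λ t → v t * extend g t) ≡ Σℤ (λ t → v (toℕ t) * g t)
∑-extend≡Σℤ {k} v g = sym (trans (Σℤ≡∑ (λ t → v (toℕ t) * g t))
  (∑-cong k (λ t t<k → trans (extend-* (λ a → v (toℕ a)) g t) (cong (_* extend g t) (extend-restrict v t t<k)))))

dot-extend-+ : ∀ m (z0 : Fin m → ℤ) (z c : Vector) → dot m (extend (λ a → z0 a + z (toℕ a))) c ≡ dot m (extend z0) c + dot m z c
dot-extend-+ m z0 z c = trans (∑-cong m (λ i i<m → trans (cong (_* c i) (trans (extend-+ z0 (λ a → z (toℕ a)) i) (cong (extend z0 i +_) (extend-restrict z i i<m))))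
                                                 (ℤP.*-distribʳ-+ (c i) (extend z0 i) (z i))))
                          (∑-distrib-+ m (λ i → extend z0 i * c i) (λ i → z i * c i))

module Columns {m n : ℕ} (C : Mat m n) (b : Fin n → ℤ) where

  col : Fin n → Vector
  col j = extend (λ a → C a j)

  colSum : ∀ (z : Fin m → ℤ) j → Σℤ (λ i → z i * C i j) ≡ dot m (extend z) (col j)
  colSum z j = trans (Σℤ≡∑ (λ i → z i * C i j)) (∑-cong m (λ i _ → extend-* z (λ a → C a j) i))

  solves⇒∣ : ∀ q z j → solves C b q z j → ℤ.+ q ∣ dot m (extend z) (col j) - b j
  solves⇒∣ q z j h = subst (λ x → ℤ.+ q ∣ x - b j) (colSum z j) (∣ᵤ⇒∣ h)

  ∣⇒solves : ∀ q z j → ℤ.+ q ∣ dot m (extend z) (col j) - b j → solves C b q z j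
  ∣⇒solves q z j h = ∣⇒∣ᵤ (subst (λ x → ℤ.+ q ∣ x - b j) (sym (colSum z j)) h)

  module _ (J : Subset n) where
    k : ℕ
    k = card J
    M : Matrix
    M = extend₂ (subC C J)
    Â : Matrix
    Â = extend₂ (subA C b J)
    bJ : Vector
    bJ = extend (λ t → b (sel J t))

    M-col : ∀ (v : Vector) (t : Fin k) → (v ⋆⟨ m ⟩ M) (toℕ t) ≡ dot m v (col (sel J t))
    M-col v t = ∑-cong m (λ i _ → cong (v i *_) (extend₂-column (subC C J) i t))

    InH⇒CongMod : ∀ q z → InH C b J q z → CongMod q k (extend z ⋆⟨ m ⟩ M) bJ
    InH⇒CongMod q z h = below-by-Fin {P = λ t → ℤ.+ q ∣ (extend z ⋆⟨ m ⟩ M) t - bJ t}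
      (λ t → subst (ℤ.+ q ∣_) (sym (cong₂ _-_ (M-col (extend z) t) (extend-toℕ (λ t → b (sel J t)) t)))
                (solves⇒∣ q z (sel J t) (h (sel J t) (sel-∈ J t))))

    CongMod⇒InH : ∀ q (v : Vector) → CongMod q k (v ⋆⟨ m ⟩ M) bJ → InH C b J q (λ a → v (toℕ a))
    CongMod⇒InH q v h j jJ with ∈⇒sel J j jJ
    ... | t , refl = ∣⇒solves q (λ a → v (toℕ a)) (sel J t)
          (subst (ℤ.+ q ∣_) (cong₂ _-_ (trans (M-col v t) (∑-cong m (λ i i<m → cong (_* col (sel J t) i) (sym (extend-restrict v i i<m)))))
                                       (extend-toℕ (λ t → b (sel J t)) t))
                 (h (toℕ t) (FP.toℕ<n t)))

    Âtop : MatEq m k Â M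
    Âtop i t i<m _ = extend-cong (λ b' → extend-snocF-< m (λ i' → C i' (sel J b')) (b (sel J b')) i i<m) t

    Âbot : ∀ t → t ℕ.< k → Â m t ≡ bJ t
    Âbot t _ = extend-cong (λ b' → extend-snocF-last m (λ i' → C i' (sel J b')) (b (sel J b'))) t

dot-distrib-- : ∀ m (x y c : Vector) → dot m (λ i → x i - y i) c ≡ dot m x c - dot m y c
dot-distrib-- m x y c = trans (∑-cong m (λ i _ → lem (x i) (y i) (c i))) (∑-distrib-- m (λ i → x i * c i) (λ i → y i * c i))
  where
  lem : ∀ a b c → (a - b) * c ≡ a * c - b * c
  lem = solve-∀

module Transfer {m n : ℕ} (C : Mat m n) (colNZ : ∀ j → ¬ (∀ i → C i j ≡ 0ℤ)) (b : Fin n → ℤ)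
  (e e' rC rA : Subset n → ℕ)
  (snfC : ∀ J → T (nonemptyᵇ J) → SNF (subC C J) (rC J) (e J))
  (snfA : ∀ J → T (nonemptyᵇ J) → SNF (subA C b J) (rA J) (e' J)) where

  open Columns C b

  q* : ℕ
  q* = qStar C e e' rC rA

  e′≤q* : ∀ J → T (nonemptyᵇ J) → rA J ≡ suc (rC J) → e' J ℕ.≤ q*
  e′≤q* J ne eq = ℕP.≤-trans (maxL-≥ (∈-map⁺ e' (∈-filter⁺ (λ J → T? (nonemptyᵇ J ∧ (rA J ≡ᵇ suc (rC J))))
                       (allSubsets-∈ J) (T-∧-intro ne (ℕP.≡⇒≡ᵇ (rA J) (suc (rC J)) eq)))))
                     (ℕP.≤-trans (ℕP.m≤m⊔n _ _) (ℕP.m≤m⊔n _ _))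

  e-insert≤q* : ∀ J j → T (nonemptyᵇ J) → rC (insert j J) ≡ suc (rC J) → e (insert j J) ℕ.≤ q*
  e-insert≤q* J j ne eq = ℕP.≤-trans
    (maxL-≥ (concatMap-∈ (λ J → concatMap
             (λ j → if nonemptyᵇ J ∧ (rC (insert j J) ≡ᵇ suc (rC J))
                      then e (insert j J) ∷ [] else [])
             (allFin n)) (allSubsets-∈ J)
       (concatMap-∈ (λ j → if nonemptyᵇ J ∧ (rC (insert j J) ≡ᵇ suc (rC J))
                      then e (insert j J) ∷ [] else []) (allFin-∈ j)
          (if-∈ (e (insert j J)) (T-∧-intro ne (ℕP.≡⇒≡ᵇ (rC (insert j J)) (suc (rC J)) eq))))))
    (ℕP.≤-trans (ℕP.m≤n⊔m (q₀ e' rC rA) _) (ℕP.m≤m⊔n _ _))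

  colGcd≤q* : ∀ j → colGcd C j ℕ.≤ q*
  colGcd≤q* j = ℕP.≤-trans (maxL-≥ (∈-map⁺ (colGcd C) (allFin-∈ j))) (ℕP.m≤n⊔m _ _)

  e∣ρ₀ : ∀ J → T (nonemptyᵇ J) → e J ℕD.∣ ρ₀ e
  e∣ρ₀ J ne = lcmL-∣ (∈-map⁺ e (∈-filter⁺ (λ J → T? (nonemptyᵇ J)) (allSubsets-∈ J) ne))

  module Direction (q q' : ℕ) (q*<q : q* ℕ.< q) (ρ₀-gcd≡ : gcd (ρ₀ e) q ≡ gcd (ρ₀ e) q') where

    q>0 : 0 ℕ.< q
    q>0 = ℕP.≤-<-trans z≤n q*<q

    module ForSubset (J : Subset n) (ne : T (nonemptyᵇ J)) where
      HJ : SmithForm m (card J) (M J) (rC J) (e J)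
      HJ = SNF⇒SmithForm (snfC J ne)
      HA : SmithForm (suc m) (card J) (Â J) (rA J) (e' J)
      HA = SNF⇒SmithForm (snfA J ne)
      gcdEq : ∀ t → t ℕ.< rC J → gcd (SmithForm.d HJ t) q ≡ gcd (SmithForm.d HJ t) q'
      gcdEq t t<l = gcd-transport (SmithForm.d HJ t) (ρ₀ e) q q' (ℕD.∣-trans (SmithFormProperties.d∣e HJ t t<l) (e∣ρ₀ J ne)) ρ₀-gcd≡
      rank-step⇒e′<q : rA J ≡ suc (rC J) → e' J ℕ.< q
      rank-step⇒e′<q eq = ℕP.≤-<-trans (e′≤q* J ne eq) q*<q
      open Solvability m (card J) (M J) (rC J) (e J) HJ (Â J) (rA J) (e' J) HA (bJ J) (Âtop J) (Âbot J) q q' q>0 rank-step⇒e′<q gcdEq public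

    transfer-nonempty : ∀ J → HNonempty C b J q → HNonempty C b J q'
    transfer-nonempty J (z , hz) with nonemptyᵇ J in J≢∅
    ... | false = (λ _ → 0ℤ) , λ j j∈J → ⊥-elim (empty⇒∉ J J≢∅ j j∈J)
    ... | true  = (λ a → proj₁ r (toℕ a)) , CongMod⇒InH J q' (proj₁ r) (proj₂ r)
      where
      r : Σ Vector (λ v → CongMod q' (card J) (v ⋆⟨ m ⟩ M J) (bJ J))
      r = ForSubset.transfer J (subst T (sym J≢∅) tt) (extend z , InH⇒CongMod J q z hz)

    HSup-∅-impossible : ∀ j J → nonemptyᵇ J ≡ false → HSup C b j J q → ⊥
    HSup-∅-impossible j J J≡∅ sup = ℕP.<-irrefl refl (ℕP.<-≤-trans q*<q (ℕP.≤-trans q≤colGcd (colGcd≤q* j)))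
      where
      everything∈H : ∀ z → InH C b J q z
      everything∈H z j' jJ = ⊥-elim (empty⇒∉ J J≡∅ j' jJ)
      q∣b : ℤ.+ q ∣ b j
      q∣b = ∣0-b⇒∣b (subst (λ x → ℤ.+ q ∣ x - b j) (Σℤ-zero (λ i → ℤP.*-zeroˡ (C i j))) (∣ᵤ⇒∣ (sup (λ _ → 0ℤ) (everything∈H (λ _ → 0ℤ)))))
      q∣C : ∀ a → ℤ.+ q ∣ C a j
      q∣C a = ∣-respʳ (lem (C a j) (b j)) (∣m∣n⇒∣m+n (subst (λ x → ℤ.+ q ∣ x - b j) (Σℤ-δᶠ a (λ i → C i j)) (∣ᵤ⇒∣ (sup (λ i → δᶠ i a) (everything∈H (λ i → δᶠ i a))))) q∣b)
        where
        lem : ∀ x y → x - y + y ≡ x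
        lem = solve-∀
      q∣colGcd : q ℕD.∣ colGcd C j
      q∣colGcd = gcdL-greatest (λ i → ℤ.∣ C i j ∣) q (allFin m) (λ a → ∣⇒∣ᵤ (q∣C a))
      colGcd≢0 : ¬ colGcd C j ≡ 0
      colGcd≢0 colGcd≡0 = colNZ j (λ a → ℤP.∣i∣≡0⇒i≡0 (gcdL-zero (λ i → ℤ.∣ C i j ∣) (allFin m) a (allFin-∈ a) colGcd≡0))
      q≤colGcd : q ℕ.≤ colGcd C j
      q≤colGcd = ℕD.∣⇒≤ {{ℕ.≢-nonZero colGcd≢0}} q∣colGcd

    module TransferSup (j : Fin n) (J : Subset n) (J≢∅ : T (nonemptyᵇ J)) (j∉J : lookup J j ≡ false)
                 (z0 : Fin m → ℤ) (z0∈H : InH C b J q z0) (sup : HSup C b j J q) where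
      J' : Subset n
      J' = insert j J
      j∈J∪j : T (lookup J' j)
      j∈J∪j = subst T (sym (lookup-insert j J)) tt
      J∪j≢∅ : T (nonemptyᵇ J')
      J∪j≢∅ = ∈⇒nonempty J' j j∈J∪j
      kJ kJ' : ℕ
      kJ = card J
      kJ' = card J'
      ĉ : Vector
      ĉ = col j
      HJ : SmithForm m kJ (M J) (rC J) (e J)
      HJ = ForSubset.HJ J J≢∅

      -- Adding a homogeneous solution z to z0 ∈ H_{J,q} stays in H_{J,q}, and sup then
      -- gives (z0 + z) c_j ≡ b_j ≡ z0 c_j.
      implies : Implies m kJ (M J) ĉ q
      implies z zM≡0 = ∣-respʳ (lem (dot m (extend z0) ĉ) (b j) (dot m z ĉ))
                    (∣m∣n⇒∣m-n (subst (λ x → ℤ.+ q ∣ x - b j) (dot-extend-+ m z0 z ĉ) (solves⇒∣ q z0+z j (sup z0+z z0+z∈H)))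
                        (solves⇒∣ q z0 j (sup z0 z0∈H)))
        where
        lem : ∀ x y w → x + w - y - (x - y) ≡ w
        lem = solve-∀
        z0+z : Fin m → ℤ
        z0+z a = z0 a + z (toℕ a)
        z0+z∈H : InH C b J q z0+z
        z0+z∈H j' jJ = subst (solves C b q z0+z) (proj₂ (∈⇒sel J j' jJ)) (z0+z-solves (proj₁ (∈⇒sel J j' jJ)))
          where
          lem3 : ∀ x y w → x - y + w ≡ x + w - y
          lem3 = solve-∀
          lem2 : ∀ x y w v → v ≡ x + w → x - y + w ≡ v - y
          lem2 x y w v eq = trans (lem3 x y w) (cong (_- y) (sym eq))
          z0+z-solves : ∀ (t : Fin kJ) → solves C b q z0+z (sel J t)
          z0+z-solves t = ∣⇒solves q z0+z (sel J t)
              (∣-respʳ (lem2 (dot m (extend z0) (col (sel J t))) (b (sel J t)) (dot m z (col (sel J t))) (dot m (extend z0+z) (col (sel J t))) (dot-extend-+ m z0 z (col (sel J t))))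
                  (∣m∣n⇒∣m+n (solves⇒∣ q z0 (sel J t) (z0∈H (sel J t) (sel-∈ J t)))
                      (∣-respʳ (trans (ℤP.+-identityʳ _) (M-col J z t)) (zM≡0 (toℕ t) (FP.toℕ<n t)))))

      M2 : Matrix
      M2 = (extend₂ (subC C J')) ᵀ
      H2 : SmithForm kJ' m M2 (rC J') (e J')
      H2 = SmithForm-ᵀ (SNF⇒SmithForm (snfC J' J∪j≢∅))

      open InsertColumn j J j∉J using (split-combination; join-combination)

      row[J∪j] : ∀ (u : Vector) (a : Fin m) → (u ⋆⟨ kJ' ⟩ M2) (toℕ a) ≡ Σℤ (λ t → u (toℕ t) * C a (sel J' t))
      row[J∪j] u a = trans (∑-cong kJ' (λ t _ → cong (u t *_) (extend₂-row (subC C J') a t))) (∑-extend≡Σℤ u (λ t → C a (sel J' t)))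

      row[J] : ∀ (y : Vector) (a : Fin m) → (y ⋆⟨ kJ ⟩ (M J ᵀ)) (toℕ a) ≡ Σℤ (λ t → y (toℕ t) * C a (sel J t))
      row[J] y a = trans (∑-cong kJ (λ t _ → cong (y t *_) (extend₂-row (subC C J) a t))) (∑-extend≡Σℤ y (λ t → C a (sel J t)))

      split-row : ∀ u → Σ Vector λ y → Σ ℤ λ s → VecEq m (u ⋆⟨ kJ' ⟩ M2) (λ i → (y ⋆⟨ kJ ⟩ (M J ᵀ)) i + s * ĉ i)
      split-row u =
        let (yF , s , eqF) = split-combination (λ t → u (toℕ t)) in
        extend yF , s , below-by-Fin {P = λ i → (u ⋆⟨ kJ' ⟩ M2) i ≡ (extend yF ⋆⟨ kJ ⟩ (M J ᵀ)) i + s * ĉ i}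
          (λ a → trans (row[J∪j] u a) (trans (eqF (C a))
             (sym (cong₂ _+_ (trans (row[J] (extend yF) a) (Σℤ-cong (λ t → cong (_* C a (sel J t)) (extend-toℕ yF t))))
                             (cong (s *_) (extend-toℕ (λ a → C a j) a))))))

      join-row : ∀ y s → Σ Vector λ u → VecEq m (u ⋆⟨ kJ' ⟩ M2) (λ i → (y ⋆⟨ kJ ⟩ (M J ᵀ)) i + s * ĉ i)
      join-row y s =
        let (uF , eqF) = join-combination (λ t → y (toℕ t)) s in
        extend uF , below-by-Fin {P = λ i → (extend uF ⋆⟨ kJ' ⟩ M2) i ≡ (y ⋆⟨ kJ ⟩ (M J ᵀ)) i + s * ĉ i}
          (λ a → trans (row[J∪j] (extend uF) a) (trans (Σℤ-cong (λ t → cong (_* C a (sel J' t)) (extend-toℕ uF t)))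
             (trans (eqF (C a)) (sym (cong₂ _+_ (row[J] y a) (cong (s *_) (extend-toℕ (λ a → C a j) a)))))))

      rank-step⇒e<q : rC J' ≡ suc (rC J) → e J' ℕ.< q
      rank-step⇒e<q eq = ℕP.≤-<-trans (e-insert≤q* J j J≢∅ eq) q*<q

      open Implication m kJ (M J) (rC J) (e J) HJ ĉ kJ' M2 (rC J') (e J') H2 split-row join-row q q' q>0 rank-step⇒e<q (ForSubset.gcdEq J J≢∅)

      implies′ : Implies m kJ (M J) ĉ q'
      implies′ = transfer-Implies implies

      z0∈H[J∪j] : InH C b J' q z0
      z0∈H[J∪j] j' jJ with j F.≟ j'
      ... | yes refl = sup z0 z0∈H
      ... | no j≢j' = z0∈H j' (subst T (lookup-insert-≢ j j' J j≢j') jJ)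

      HSup-mod-q′ : HSup C b j J q'
      HSup-mod-q′ z hz = ∣⇒solves q' z j
            (∣-respʳ (lem (dot m (extend z) ĉ) (dot m (extend z1) ĉ) (b j))
                (∣m∣n⇒∣m+n (∣-respʳ (dot-distrib-- m (extend z) (extend z1) ĉ) (implies′ v hv)) (solves⇒∣ q' z1 j (hz1 j j∈J∪j))))
        where
        lem : ∀ x y w → x - y + (y - w) ≡ x - w
        lem = solve-∀
        r : HNonempty C b J' q'
        r = transfer-nonempty J' (z0 , z0∈H[J∪j])
        z1 : Fin m → ℤ
        z1 = proj₁ r
        hz1 : InH C b J' q' z1
        hz1 = proj₂ r
        v : Vector
        v i = extend z i - extend z1 i
        inJ : ∀ j' → T (lookup J j') → T (lookup J' j')
        inJ j' h with j F.≟ j'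
        ... | yes refl = ⊥-elim (subst T j∉J h)
        ... | no j≢j' = subst T (sym (lookup-insert-≢ j j' J j≢j')) h
        hv : CongMod q' kJ (v ⋆⟨ m ⟩ M J) (λ _ → 0ℤ)
        hv = below-by-Fin {P = λ t → ℤ.+ q' ∣ (v ⋆⟨ m ⟩ M J) t - 0ℤ} hvF
          where
          lem2 : ∀ x y w → x - w - (y - w) ≡ x - y
          lem2 = solve-∀
          hvF : ∀ (t : Fin kJ) → ℤ.+ q' ∣ (v ⋆⟨ m ⟩ M J) (toℕ t) - 0ℤ
          hvF t = ∣-respʳ eqq (∣m∣n⇒∣m-n (solves⇒∣ q' z (sel J t) (hz (sel J t) (sel-∈ J t)))
                             (solves⇒∣ q' z1 (sel J t) (hz1 (sel J t) (inJ (sel J t) (sel-∈ J t)))))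
            where
            c' : Vector
            c' = col (sel J t)
            eqq : dot m (extend z) c' - b (sel J t) - (dot m (extend z1) c' - b (sel J t)) ≡ (v ⋆⟨ m ⟩ M J) (toℕ t) - 0ℤ
            eqq = trans (lem2 (dot m (extend z) c') (dot m (extend z1) c') (b (sel J t)))
                   (trans (sym (dot-distrib-- m (extend z) (extend z1) c'))
                   (trans (sym (M-col J v t)) (sym (ℤP.+-identityʳ _))))

    transfer-HSup : ∀ j J → HNonempty C b J q → HSup C b j J q → HSup C b j J q'
    transfer-HSup j J (z0 , hz0) sup with lookup J j in j∈J | nonemptyᵇ J in J≢∅
    ... | true  | _     = λ z hz → hz j (subst T (sym j∈J) tt)
    ... | false | false = ⊥-elim (HSup-∅-impossible j J J≢∅ sup)
    ... | false | true  = TransferSup.HSup-mod-q′ j J (subst T (sym J≢∅) tt) j∈J z0 hz0 sup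

theorem4p2 : (m n : ℕ) → 1 ≤ m → 1 ≤ n →
    (C : Mat m n) → (∀ j → ¬ (∀ i → C i j ≡ 0ℤ)) →
    (b : Fin n → ℤ) →
    (e e' rC rA : Subset n → ℕ) →
    (∀ J → T (nonemptyᵇ J) → SNF (subC C J) (rC J) (e J)) →
    (∀ J → T (nonemptyᵇ J) → SNF (subA C b J) (rA J) (e' J)) →
    (q q' : ℕ) →
    qStar C e e' rC rA < q → qStar C e e' rC rA < q' →
    gcd (ρ₀ e) q ≡ gcd (ρ₀ e) q' →
    ((J : Subset n) → HEmpty C b J q ⇔ HEmpty C b J q')
    ×
    ((j : Fin n) (J : Subset n) → HNonempty C b J q → HNonempty C b J q' →
    HSup C b j J q ⇔ HSup C b j J q')
theorem4p2 m n _ _ C colNZ b e e' rC rA snfC snfA q q' q*<q q*<q' ρ₀-gcd≡ =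
  (λ J → mk⇔ (λ ∅q h′ → ∅q (q′→q.transfer-nonempty J h′)) (λ ∅q′ h → ∅q′ (q→q′.transfer-nonempty J h))) ,
  (λ j J h h′ → mk⇔ (q→q′.transfer-HSup j J h) (q′→q.transfer-HSup j J h′))
  where
  open Transfer C colNZ b e e' rC rA snfC snfA
  module q→q′ = Direction q q' q*<q ρ₀-gcd≡
  module q′→q = Direction q' q q*<q' (sym ρ₀-gcd≡)
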